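{- $$\sum_{n\ge0}S_n^{D,+}\frac{x^n}{n!}=\frac{2\cos^2x-\sin^2x}{2(\cos x-\sin x)},\qquad \sum_{n\ge0}S_n^{D,- }\frac{x^n}{n!}=\frac{\sin^2x}{2(\cos x-\sin x)},$$ $$\sum_{n\ge0}S_n^{B-D,+}\frac{x^n}{n!}=\sum_{n\ge0}S_n^{B-D,- }\frac{x^n}{n!}=\frac{\sin^2x}{2(\cos x-\sin x)}.$$
   Context: $\mathfrak{B}_n$ is the group of signed permutations in window notation $\pi=\pi_1\cdots\pi_n$, and $\mathfrak{D}_n$ the subset with an even number of negative entries. For $\pi\in\mathfrak{B}_n$, $\mathrm{inv}_D(\pi)=|\{i<j:\pi_i>\pi_j\}|+|\{i<j:-\pi_i>\pi_j\}|$. A snake is $\pi\in\mathfrak{B}_n$ with $0<\pi_1>\pi_2<\pi_3>\cdots$. For $n\ge1$, $S_n^{D,\pm}$ is the number of snakes in $\mathfrak{D}_n$ with $\mathrm{inv}_D$ even ($+$) or odd ($-$), and $S_n^{B-D,\pm}$ the number of snakes in $\mathfrak{B}_n\setminus\mathfrak{D}_n$ with $\mathrm{inv}_D$ even ($+$) or odd ($-$). Conventions: $S_0^{D,+}=1$, $S_0^{D,- }=S_0^{B-D,+}=S_0^{B-D,- }=0$. -}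

module Defs where

open import Data.Bool using (Bool; true; false; _∧_; not; if_then_else_)
open import Data.Nat as ℕ using (ℕ; zero; suc; _!)
open import Data.Nat.Properties using (_!≢0)
open import Data.Integer as ℤ using (ℤ; +_; -_)
import Data.Integer.Properties as ℤP
open import Data.Rational as ℚ using (ℚ; _/_)
open import Data.List using (List; []; _∷_; map; concatMap; upTo; foldr)
open import Relation.Nullary.Decidable using (isYes)
open import Relation.Binary.PropositionalEquality using (_≡_)

insertions : {A : Set} → A → List A → List (List A)
insertions x []       = (x ∷ []) ∷ []
insertions x (y ∷ ys) = (x ∷ y ∷ ys) ∷ map (y ∷_) (insertions x ys)

perms : {A : Set} → List A → List (List A)
perms []       = [] ∷ []
perms (x ∷ xs) = concatMap (insertions x) (perms xs)

signings : List ℕ → List (List ℤ)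
signings []       = [] ∷ []
signings (k ∷ ks) = concatMap (λ s → (+ k ∷ s) ∷ (- (+ k) ∷ s) ∷ []) (signings ks)

-- B n : the hyperoctahedral group 𝔅_n, each signed permutation listed
-- exactly once in window notation π₁ ⋯ πₙ
B : ℕ → List (List ℤ)
B n = concatMap signings (perms (map suc (upTo n)))

infix 4 _<ᵇ_
_<ᵇ_ : ℤ → ℤ → Bool
x <ᵇ y = isYes (x ℤ.<? y)

count : {A : Set} → (A → Bool) → List A → ℕ
count p = foldr (λ a n → if p a then suc n else n) 0

neg : List ℤ → ℕ
neg = count (λ x → x <ᵇ + 0)

even : ℕ → Bool
even zero          = true
even (suc zero)    = false
even (suc (suc n)) = even n

inD : List ℤ → Bool
inD π = even (neg π)

invD : List ℤ → ℕ
invD []       = 0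
invD (x ∷ xs) = count (λ y → y <ᵇ x) xs ℕ.+ count (λ y → y <ᵇ (- x)) xs ℕ.+ invD xs

mutual
  downFrom : ℤ → List ℤ → Bool
  downFrom x []       = true
  downFrom x (y ∷ ys) = (y <ᵇ x) ∧ upFrom y ys

  upFrom : ℤ → List ℤ → Bool
  upFrom x []       = true
  upFrom x (y ∷ ys) = (x <ᵇ y) ∧ downFrom y ys

isSnake : List ℤ → Bool
isSnake π = upFrom (+ 0) π

SD⁺ SD⁻ SBD⁺ SBD⁻ : ℕ → ℕ
SD⁺ zero = 1
SD⁺ n    = count (λ π → isSnake π ∧ inD π ∧ even (invD π)) (B n)
SD⁻ zero = 0
SD⁻ n    = count (λ π → isSnake π ∧ inD π ∧ not (even (invD π))) (B n)
SBD⁺ zero = 0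
SBD⁺ n    = count (λ π → isSnake π ∧ not (inD π) ∧ even (invD π)) (B n)
SBD⁻ zero = 0
SBD⁻ n    = count (λ π → isSnake π ∧ not (inD π) ∧ not (even (invD π))) (B n)

PS : Set
PS = ℕ → ℚ

egf : (ℕ → ℤ) → PS
egf a n = a n / (n !) where instance _ = n !≢0

-- derivatives at 0 of sin and cos
sinD cosD : ℕ → ℤ
sinD zero          = + 0
sinD (suc zero)    = + 1
sinD (suc (suc n)) = - sinD n
cosD zero          = + 1
cosD (suc zero)    = + 0
cosD (suc (suc n)) = - cosD n

sinS cosS : PS
sinS = egf sinD
cosS = egf cosD

_⊕_ _⊖_ _⊛_ : PS → PS → PS
(f ⊕ g) n = f n ℚ.+ g n
(f ⊖ g) n = f n ℚ.- g n
(f ⊛ g) n = foldr ℚ._+_ ℚ.0ℚ (map (λ k → f k ℚ.* g (n ℕ.∸ k)) (upTo (suc n)))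

_·_ : ℚ → PS → PS
(c · f) n = c ℚ.* f n

infixl 6 _⊕_ _⊖_
infixl 7 _⊛_ _·_

two : ℚ
two = ℚ.1ℚ ℚ.+ ℚ.1ℚ

_≐_ : PS → PS → Set
f ≐ g = ∀ n → f n ≡ g n
infix 4 _≐_

-- Let T and Z be the exponential generating functions of the snakes in 𝔅ₙ and of the signed
-- permutations with π₁ > π₂ < π₃ > ⋯. Cutting such a permutation at its entry ±n leaves two
-- alternating pieces whose entries may be any complementary sets of absolute values, which gives
-- T′ = T Z and Z′ = Z² + 1; hence Z (cos x − sin x) = cos x + sin x and T (cos x − sin x) = 1.
-- The sums over snakes of (−1)^neg, of (−1)^inv_D and of their product all equal cos x + sin x:
-- for the first and the last, changing the sign of the entry ±1 cancels every snake in which it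
-- is not in front, which leads to the recurrence of cos + sin; for the middle one, the placements
-- of ±1 and ±2 cancel in pairs except 2 1 in front, so the sum changes sign every two steps.
-- Since 4·[π in a class] = [π snake] (1 ± (−1)^neg) (1 ± (−1)^inv_D), the class counts are
-- (T + 3 (cos x + sin x))/4 for the even class of 𝔇ₙ and (T − (cos x + sin x))/4 for the other
-- three, and multiplying by 2 (cos x − sin x) gives the four identities.

module Submission where

open import Defs
open import Data.Bool using (Bool; true; false; _∧_; not)
open import Data.Bool.Properties using (∧-assoc; not-involutive)
open import Data.Empty using (⊥-elim)
open import Data.Integer as ℤ using (ℤ; +_; -[1+_]; -_; _+_; _*_; _-_)
import Data.Integer.Properties as ℤP
open import Data.Integer.Solver using (module +-*-Solver)
open import Data.List using (List; []; _∷_; _++_; map; concatMap; foldr; length; null; upTo; applyUpTo)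
open import Data.List.Properties using (map-cong; map-cong-local; map-upTo; ++-assoc; length-map)
open import Data.List.Membership.Propositional using (_∈_)
open import Data.List.Membership.Propositional.Properties using (∈-upTo⁻; ∈-map⁻)
open import Data.List.Relation.Unary.All using (All; []; _∷_)
import Data.List.Relation.Unary.All as All
open import Data.List.Relation.Unary.Any using (here; there)
open import Data.Nat as ℕ using (ℕ; zero; suc; z≤n; s≤s; _!; _∸_)
open import Data.Nat.Combinatorics using (_C_; nCk≡n!/k![n-k]!; nCk+nC[k+1]≡[n+1]C[k+1]; nCn≡1; k![n∸k]!∣n!)
open import Data.Nat.DivMod using (m/n*n≡m)
import Data.Nat.Properties as ℕP
open import Data.Nat.Properties using (_!≢0; _!*_!≢0)
open import Data.Product using (_×_; _,_; proj₁; proj₂; map₁)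
open import Data.Rational as ℚ using (ℚ; _/_)
import Data.Rational.Properties as ℚP
open import Data.Rational.Unnormalised as ℚᵘ using (ℚᵘ; mkℚᵘ; *≡*)
import Data.Rational.Unnormalised.Properties as ℚᵘP
open import Data.Unit using (⊤; tt)
open import Function using (_∘_)
open import Function.Bundles using (_⇔_; mk⇔)
open import Relation.Binary.Core using (_Preserves_⟶_)
open import Relation.Binary.Definitions using (tri<; tri≈; tri>)
open import Relation.Binary.PropositionalEquality
open import Relation.Nullary using (¬_)
open import Relation.Nullary.Decidable using (isYes≗does; does-⇔; dec-true; dec-false)

import Algebra.Properties.CommutativeSemigroup ℤP.+-commutativeSemigroup as ℤ+
import Algebra.Properties.CommutativeSemigroup ℕP.+-commutativeSemigroup as ℕ+
open ≡-Reasoning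
open +-*-Solver

private
  variable
    A A′ : Set
    P : A → Set
    x x′ : ℤ

∑ : (A → ℤ) → List A → ℤ
∑ f []       = + 0
∑ f (x ∷ xs) = f x + ∑ f xs

∑-cong : {f g : A → ℤ} → (∀ x → f x ≡ g x) → (xs : List A) → ∑ f xs ≡ ∑ g xs
∑-cong f≗g []       = refl
∑-cong f≗g (x ∷ xs) = cong₂ _+_ (f≗g x) (∑-cong f≗g xs)

∑-cong-∈ : {f g : A → ℤ} (xs : List A) → (∀ x → x ∈ xs → f x ≡ g x) → ∑ f xs ≡ ∑ g xs
∑-cong-∈ []       f≗g = refl
∑-cong-∈ (x ∷ xs) f≗g = cong₂ _+_ (f≗g x (here refl)) (∑-cong-∈ xs (λ y y∈ → f≗g y (there y∈)))

∑-zero : {f : A → ℤ} (xs : List A) → (∀ x → x ∈ xs → f x ≡ + 0) → ∑ f xs ≡ + 0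
∑-zero xs f≗0 = trans (∑-cong-∈ xs f≗0) (∑-const0 xs)
  where
  ∑-const0 : (xs : List A) → ∑ (λ _ → + 0) xs ≡ + 0
  ∑-const0 []       = refl
  ∑-const0 (_ ∷ xs) = trans (ℤP.+-identityˡ _) (∑-const0 xs)

∑-++ : (f : A → ℤ) (xs ys : List A) → ∑ f (xs ++ ys) ≡ ∑ f xs + ∑ f ys
∑-++ f []       ys = sym (ℤP.+-identityˡ _)
∑-++ f (x ∷ xs) ys = trans (cong (_+_ (f x)) (∑-++ f xs ys)) (sym (ℤP.+-assoc (f x) _ _))

∑-+ : (f g : A → ℤ) (xs : List A) → ∑ (λ x → f x + g x) xs ≡ ∑ f xs + ∑ g xs
∑-+ f g []       = refl
∑-+ f g (x ∷ xs) = trans (cong (_+_ (f x + g x)) (∑-+ f g xs)) (ℤ+.interchange (f x) (g x) (∑ f xs) (∑ g xs))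

∑-neg : (f : A → ℤ) (xs : List A) → ∑ (λ x → - f x) xs ≡ - ∑ f xs
∑-neg f []       = refl
∑-neg f (x ∷ xs) = trans (cong (_+_ (- f x)) (∑-neg f xs)) (sym (ℤP.neg-distrib-+ (f x) _))

∑-*ˡ : (c : ℤ) (f : A → ℤ) (xs : List A) → ∑ (λ x → c * f x) xs ≡ c * ∑ f xs
∑-*ˡ c f []       = sym (ℤP.*-zeroʳ c)
∑-*ˡ c f (x ∷ xs) = trans (cong (_+_ (c * f x)) (∑-*ˡ c f xs)) (sym (ℤP.*-distribˡ-+ c (f x) _))

∑-*ʳ : (c : ℤ) (f : A → ℤ) (xs : List A) → ∑ (λ x → f x * c) xs ≡ ∑ f xs * c
∑-*ʳ c f []       = refl
∑-*ʳ c f (x ∷ xs) = trans (cong (_+_ (f x * c)) (∑-*ʳ c f xs)) (sym (ℤP.*-distribʳ-+ c (f x) _))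

∑-map : (f : A′ → ℤ) (g : A → A′) (xs : List A) → ∑ f (map g xs) ≡ ∑ (λ x → f (g x)) xs
∑-map f g []       = refl
∑-map f g (x ∷ xs) = cong (_+_ (f (g x))) (∑-map f g xs)

∑-concatMap : (f : A′ → ℤ) (g : A → List A′) (xs : List A) →
              ∑ f (concatMap g xs) ≡ ∑ (λ x → ∑ f (g x)) xs
∑-concatMap f g []       = refl
∑-concatMap f g (x ∷ xs) = trans (∑-++ f (g x) (concatMap g xs)) (cong (_+_ (∑ f (g x))) (∑-concatMap f g xs))

𝟙 : Bool → ℤ
𝟙 true  = + 1
𝟙 false = + 0

sign : Bool → ℤ
sign true  = + 1
sign false = -[1+ 0 ]

count≡∑𝟙 : (p : A → Bool) (xs : List A) → + count p xs ≡ ∑ (λ x → 𝟙 (p x)) xs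
count≡∑𝟙 p []       = refl
count≡∑𝟙 p (x ∷ xs) with p x
... | true  = cong (_+_ (+ 1)) (count≡∑𝟙 p xs)
... | false = trans (count≡∑𝟙 p xs) (sym (ℤP.+-identityˡ _))

count-++ : (p : A → Bool) (xs ys : List A) → count p (xs ++ ys) ≡ count p xs ℕ.+ count p ys
count-++ p []       ys = refl
count-++ p (x ∷ xs) ys with p x
... | true  = cong suc (count-++ p xs ys)
... | false = count-++ p xs ys

count-replace : (p : A → Bool) {x x′ : A} (xs ys : List A) → p x ≡ p x′ →
                count p (xs ++ x ∷ ys) ≡ count p (xs ++ x′ ∷ ys)
count-replace p xs ys px≡px′ =
  trans (count-++ p xs _) (trans (cong (count p xs ℕ.+_) (head px≡px′)) (sym (count-++ p xs _)))
  where
  head : ∀ {x x′} → p x ≡ p x′ → count p (x ∷ ys) ≡ count p (x′ ∷ ys)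
  head {x} {x′} eq with p x | p x′
  head refl | true  | true  = refl
  head refl | false | false = refl

count-map : (p : A′ → Bool) (f : A → A′) (xs : List A) → count p (map f xs) ≡ count (λ x → p (f x)) xs
count-map p f []       = refl
count-map p f (x ∷ xs) rewrite count-map p f xs = refl

count-cong-All : {p q : A → Bool} → (∀ {x} → P x → p x ≡ q x) →
                 {xs : List A} → All P xs → count p xs ≡ count q xs
count-cong-All p≗q []         = refl
count-cong-All p≗q (px ∷ pxs) rewrite p≗q px | count-cong-All p≗q pxs = refl

even-suc : (m : ℕ) → even (suc m) ≡ not (even m)
even-suc zero    = refl
even-suc (suc m) = trans (sym (not-involutive (even m))) (cong not (sym (even-suc m)))

𝟙-∧ : (a b : Bool) → 𝟙 (a ∧ b) ≡ 𝟙 a * 𝟙 b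
𝟙-∧ true  b = sym (ℤP.*-identityˡ (𝟙 b))
𝟙-∧ false b = refl

𝟙-∧-∧ : (a b c : Bool) → 𝟙 (a ∧ (b ∧ c)) ≡ 𝟙 (a ∧ b) * 𝟙 c
𝟙-∧-∧ a b c = trans (cong 𝟙 (sym (∧-assoc a b c))) (𝟙-∧ (a ∧ b) c)

𝟙-∧-split : (a b : Bool) → 𝟙 (a ∧ b) + 𝟙 (a ∧ not b) ≡ 𝟙 a
𝟙-∧-split true  true  = refl
𝟙-∧-split true  false = refl
𝟙-∧-split false b     = refl

sign-not : (b : Bool) → sign (not b) ≡ - sign b
sign-not true  = refl
sign-not false = refl

even-double : (a m : ℕ) → even (a ℕ.+ a ℕ.+ m) ≡ even m
even-double zero    m = refl
even-double (suc a) m rewrite ℕP.+-suc a a = even-double a m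

s*sign+s*sign-not : (s : ℤ) (b : Bool) → s * sign b + s * sign (not b) ≡ + 0
s*sign+s*sign-not s b = begin
  s * sign b + s * sign (not b)   ≡⟨ cong (λ z → s * sign b + s * z) (sign-not b) ⟩
  s * sign b + s * - sign b       ≡⟨ cong (_+_ (s * sign b)) (sym (ℤP.neg-distribʳ-* s (sign b))) ⟩
  s * sign b - s * sign b         ≡⟨ ℤP.+-inverseʳ (s * sign b) ⟩
  + 0                             ∎

even-+-flip : (m : ℕ) {a b : ℕ} → even a ≡ not (even b) → even (m ℕ.+ a) ≡ not (even (m ℕ.+ b))
even-+-flip zero            flip = flip
even-+-flip (suc m) {a} {b} flip =
  trans (even-suc (m ℕ.+ a)) (cong not (trans (even-+-flip m flip) (sym (even-suc (m ℕ.+ b)))))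

Seq : Set
Seq = ℕ → ℤ

∂ : Seq → Seq
∂ a n = a (suc n)

infixl 6 _⊞_ _⊟_
infixl 7 _⊠_ _⋆_
infix  8 ⊟_

_⊞_ _⊟_ : Seq → Seq → Seq
(a ⊞ b) n = a n + b n
(a ⊟ b) n = a n - b n

⊟_ : Seq → Seq
(⊟ a) n = - a n

_⊠_ : ℤ → Seq → Seq
(c ⊠ a) n = c * a n

δ : Seq
δ zero    = + 1
δ (suc n) = + 0

-- (a ⋆ b) n = Σₖ C(n,k) aₖ bₙ₋ₖ, the product of exponential generating functions, defined
-- through the Leibniz rule so that no binomial coefficients appear.
_⋆_ : Seq → Seq → Seq
(a ⋆ b) zero    = a 0 * b 0
(a ⋆ b) (suc n) = (∂ a ⋆ b) n + (a ⋆ ∂ b) n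

⋆-cong : {a a′ b b′ : Seq} → a ≗ a′ → b ≗ b′ → a ⋆ b ≗ a′ ⋆ b′
⋆-cong a≗a′ b≗b′ zero    = cong₂ _*_ (a≗a′ 0) (b≗b′ 0)
⋆-cong a≗a′ b≗b′ (suc n) =
  cong₂ _+_ (⋆-cong (a≗a′ ∘ suc) b≗b′ n) (⋆-cong a≗a′ (b≗b′ ∘ suc) n)

⋆-congˡ : {a a′ : Seq} (b : Seq) → a ≗ a′ → a ⋆ b ≗ a′ ⋆ b
⋆-congˡ b a≗a′ = ⋆-cong a≗a′ (λ _ → refl)

⋆-congʳ : (a : Seq) {b b′ : Seq} → b ≗ b′ → a ⋆ b ≗ a ⋆ b′
⋆-congʳ a = ⋆-cong (λ _ → refl)

⋆-comm : (a b : Seq) → a ⋆ b ≗ b ⋆ a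
⋆-comm a b zero    = ℤP.*-comm (a 0) (b 0)
⋆-comm a b (suc n) =
  trans (cong₂ _+_ (⋆-comm (∂ a) b n) (⋆-comm a (∂ b) n)) (ℤP.+-comm ((b ⋆ ∂ a) n) _)

⋆-distribʳ-⊞ : (a a′ b : Seq) → (a ⊞ a′) ⋆ b ≗ a ⋆ b ⊞ a′ ⋆ b
⋆-distribʳ-⊞ a a′ b zero    = ℤP.*-distribʳ-+ (b 0) (a 0) (a′ 0)
⋆-distribʳ-⊞ a a′ b (suc n) =
  trans (cong₂ _+_ (⋆-distribʳ-⊞ (∂ a) (∂ a′) b n) (⋆-distribʳ-⊞ a a′ (∂ b) n))
        (ℤ+.interchange ((∂ a ⋆ b) n) ((∂ a′ ⋆ b) n) ((a ⋆ ∂ b) n) ((a′ ⋆ ∂ b) n))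

⋆-distribˡ-⊞ : (a b b′ : Seq) → a ⋆ (b ⊞ b′) ≗ a ⋆ b ⊞ a ⋆ b′
⋆-distribˡ-⊞ a b b′ n = begin
  (a ⋆ (b ⊞ b′)) n          ≡⟨ ⋆-comm a (b ⊞ b′) n ⟩
  ((b ⊞ b′) ⋆ a) n          ≡⟨ ⋆-distribʳ-⊞ b b′ a n ⟩
  (b ⋆ a ⊞ b′ ⋆ a) n        ≡⟨ cong₂ _+_ (⋆-comm b a n) (⋆-comm b′ a n) ⟩
  (a ⋆ b ⊞ a ⋆ b′) n        ∎

⋆-⊠ˡ : (c : ℤ) (a b : Seq) → (c ⊠ a) ⋆ b ≗ c ⊠ (a ⋆ b)
⋆-⊠ˡ c a b zero    = ℤP.*-assoc c (a 0) (b 0)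
⋆-⊠ˡ c a b (suc n) =
  trans (cong₂ _+_ (⋆-⊠ˡ c (∂ a) b n) (⋆-⊠ˡ c a (∂ b) n)) (sym (ℤP.*-distribˡ-+ c _ _))

⋆-⊠ʳ : (c : ℤ) (a b : Seq) → a ⋆ (c ⊠ b) ≗ c ⊠ (a ⋆ b)
⋆-⊠ʳ c a b n = trans (⋆-comm a (c ⊠ b) n) (trans (⋆-⊠ˡ c b a n) (cong (c *_) (⋆-comm b a n)))

⋆-negˡ : (a b : Seq) → (⊟ a) ⋆ b ≗ ⊟ (a ⋆ b)
⋆-negˡ a b n = begin
  ((⊟ a) ⋆ b) n              ≡⟨ ⋆-congˡ b (λ k → sym (ℤP.-1*i≡-i (a k))) n ⟩
  ((-[1+ 0 ] ⊠ a) ⋆ b) n     ≡⟨ ⋆-⊠ˡ -[1+ 0 ] a b n ⟩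
  -[1+ 0 ] * (a ⋆ b) n       ≡⟨ ℤP.-1*i≡-i _ ⟩
  - (a ⋆ b) n                ∎

⋆-negʳ : (a b : Seq) → a ⋆ (⊟ b) ≗ ⊟ (a ⋆ b)
⋆-negʳ a b n = trans (⋆-comm a (⊟ b) n) (trans (⋆-negˡ b a n) (cong -_ (⋆-comm b a n)))

⋆-assoc : (a b c : Seq) → (a ⋆ b) ⋆ c ≗ a ⋆ (b ⋆ c)
⋆-assoc a b c zero    = ℤP.*-assoc (a 0) (b 0) (c 0)
⋆-assoc a b c (suc n) = begin
  ((∂ a ⋆ b ⊞ a ⋆ ∂ b) ⋆ c ⊞ (a ⋆ b) ⋆ ∂ c) n
    ≡⟨ cong (_+ ((a ⋆ b) ⋆ ∂ c) n) (⋆-distribʳ-⊞ (∂ a ⋆ b) (a ⋆ ∂ b) c n) ⟩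
  ((∂ a ⋆ b) ⋆ c ⊞ (a ⋆ ∂ b) ⋆ c ⊞ (a ⋆ b) ⋆ ∂ c) n
    ≡⟨ cong₂ _+_ (cong₂ _+_ (⋆-assoc (∂ a) b c n) (⋆-assoc a (∂ b) c n)) (⋆-assoc a b (∂ c) n) ⟩
  (∂ a ⋆ (b ⋆ c) ⊞ a ⋆ (∂ b ⋆ c) ⊞ a ⋆ (b ⋆ ∂ c)) n
    ≡⟨ ℤP.+-assoc ((∂ a ⋆ (b ⋆ c)) n) _ _ ⟩
  (∂ a ⋆ (b ⋆ c)) n + (a ⋆ (∂ b ⋆ c) ⊞ a ⋆ (b ⋆ ∂ c)) n
    ≡⟨ cong (_+_ ((∂ a ⋆ (b ⋆ c)) n)) (sym (⋆-distribˡ-⊞ a (∂ b ⋆ c) (b ⋆ ∂ c) n)) ⟩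
  (∂ a ⋆ (b ⋆ c) ⊞ a ⋆ ∂ (b ⋆ c)) n
    ∎

⋆-vanishes : (a b : Seq) (n : ℕ) → (∀ k → k ℕ.≤ n → b k ≡ + 0) → (a ⋆ b) n ≡ + 0
⋆-vanishes a b zero    b≡0 = trans (cong (a 0 *_) (b≡0 0 z≤n)) (ℤP.*-zeroʳ (a 0))
⋆-vanishes a b (suc n) b≡0 = cong₂ _+_
  (⋆-vanishes (∂ a) b n (λ k k≤n → b≡0 k (ℕP.m≤n⇒m≤1+n k≤n)))
  (⋆-vanishes a (∂ b) n (λ k k≤n → b≡0 (suc k) (s≤s k≤n)))

⋆-identityˡ : (a : Seq) → δ ⋆ a ≗ a
⋆-identityˡ a zero    = ℤP.*-identityˡ (a 0)
⋆-identityˡ a (suc n) =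
  trans (cong₂ _+_ (trans (⋆-comm (∂ δ) a n) (⋆-vanishes a (∂ δ) n (λ _ _ → refl))) (⋆-identityˡ (∂ a) n))
        (ℤP.+-identityˡ _)

∂≗⋆-vanishes : (z u : Seq) → u 0 ≡ + 0 → ∂ u ≗ z ⋆ u → ∀ n → u n ≡ + 0
∂≗⋆-vanishes z u u₀≡0 ∂u≗z⋆u n = below n n ℕP.≤-refl
  where
  below : ∀ m k → k ℕ.≤ m → u k ≡ + 0
  below _       zero    _         = u₀≡0
  below (suc m) (suc k) (s≤s k≤m) =
    trans (∂u≗z⋆u k) (⋆-vanishes z u k (λ j j≤k → below m j (ℕP.≤-trans j≤k k≤m)))

∂cos : ∂ cosD ≗ ⊟ sinD
∂sin : ∂ sinD ≗ cosD
∂cos zero    = refl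
∂cos (suc n) = cong -_ (sym (∂sin n))
∂sin zero    = refl
∂sin (suc n) = sym (∂cos n)

cos+sin cos-sin : Seq
cos+sin = cosD ⊞ sinD
cos-sin = cosD ⊟ sinD

∂[cos+sin] : ∂ cos+sin ≗ cos-sin
∂[cos+sin] n = trans (cong₂ _+_ (∂cos n) (∂sin n)) (ℤP.+-comm (- sinD n) (cosD n))

∂[cos-sin] : ∂ cos-sin ≗ ⊟ cos+sin
∂[cos-sin] n = trans (cong₂ _-_ (∂cos n) (∂sin n))
  (solve 2 (λ s c → (:- s) :- c := :- (c :+ s)) refl (sinD n) (cosD n))

cos²+sin² : cosD ⋆ cosD ⊞ sinD ⋆ sinD ≗ δ
cos²+sin² zero    = refl
cos²+sin² (suc n) = begin
  (∂ cosD ⋆ cosD ⊞ cosD ⋆ ∂ cosD ⊞ (∂ sinD ⋆ sinD ⊞ sinD ⋆ ∂ sinD)) n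
    ≡⟨ cong₂ _+_ (cong₂ _+_ (trans (⋆-congˡ cosD ∂cos n) (⋆-negˡ sinD cosD n))
                            (trans (⋆-congʳ cosD ∂cos n) (⋆-negʳ cosD sinD n)))
                 (cong₂ _+_ (⋆-congˡ sinD ∂sin n) (⋆-congʳ sinD ∂sin n)) ⟩
  (⊟ (sinD ⋆ cosD) ⊞ ⊟ (cosD ⋆ sinD) ⊞ (cosD ⋆ sinD ⊞ sinD ⋆ cosD)) n
    ≡⟨ solve 2 (λ a b → (:- a :+ :- b) :+ (b :+ a) := con (+ 0)) refl ((sinD ⋆ cosD) n) ((cosD ⋆ sinD) n) ⟩
  + 0
    ∎

[cos+sin]⋆[cos-sin] : cos+sin ⋆ cos-sin ≗ cosD ⋆ cosD ⊟ sinD ⋆ sinD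
[cos+sin]⋆[cos-sin] n = begin
  (cos+sin ⋆ cos-sin) n
    ≡⟨ ⋆-distribʳ-⊞ cosD sinD cos-sin n ⟩
  (cosD ⋆ (cosD ⊞ ⊟ sinD) ⊞ sinD ⋆ (cosD ⊞ ⊟ sinD)) n
    ≡⟨ cong₂ _+_ (⋆-distribˡ-⊞ cosD cosD (⊟ sinD) n) (⋆-distribˡ-⊞ sinD cosD (⊟ sinD) n) ⟩
  (cosD ⋆ cosD ⊞ cosD ⋆ ⊟ sinD ⊞ (sinD ⋆ cosD ⊞ sinD ⋆ ⊟ sinD)) n
    ≡⟨ cong₂ _+_ (cong (_+_ ((cosD ⋆ cosD) n)) (⋆-negʳ cosD sinD n))
                 (cong₂ _+_ (⋆-comm sinD cosD n) (⋆-negʳ sinD sinD n)) ⟩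
  (cosD ⋆ cosD ⊞ ⊟ (cosD ⋆ sinD) ⊞ (cosD ⋆ sinD ⊞ ⊟ (sinD ⋆ sinD))) n
    ≡⟨ solve 3 (λ a b c → (a :+ :- b) :+ (b :+ :- c) := a :- c) refl
               ((cosD ⋆ cosD) n) ((cosD ⋆ sinD) n) ((sinD ⋆ sinD) n) ⟩
  (cosD ⋆ cosD ⊟ sinD ⋆ sinD) n
    ∎

splits : List A → List (List A × List A)
splits []       = ([] , []) ∷ []
splits (y ∷ ys) = ([] , y ∷ ys) ∷ map (map₁ (y ∷_)) (splits ys)

All-splits : {σ : List A} → All P σ → {p : List A × List A} → p ∈ splits σ → All P (proj₁ p) × All P (proj₂ p)
All-splits []         (here refl) = [] , []
All-splits (py ∷ pys) (here refl) = [] , py ∷ pys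
All-splits (py ∷ pys) (there p∈) with ∈-map⁻ (map₁ _) p∈
... | q , q∈ , refl = map₁ (py ∷_) (All-splits pys q∈)

All-insertions : {x : A} {l π : List A} → P x → All P l → π ∈ insertions x l → All P π
All-insertions px []         (here refl) = px ∷ []
All-insertions px (py ∷ pys) (here refl) = px ∷ py ∷ pys
All-insertions px (py ∷ pys) (there π∈) with ∈-map⁻ _ π∈
... | π′ , π′∈ , refl = py ∷ All-insertions px pys π′∈

∑-insertions : (F : List A → ℤ) (x : A) (l : List A) →
               ∑ F (insertions x l) ≡ ∑ (λ (L , R) → F (L ++ x ∷ R)) (splits l)
∑-insertions F x []       = refl
∑-insertions F x (y ∷ ys) = cong (_+_ (F (x ∷ y ∷ ys))) (begin
  ∑ F (map (y ∷_) (insertions x ys))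
    ≡⟨ ∑-map F (y ∷_) (insertions x ys) ⟩
  ∑ (λ π → F (y ∷ π)) (insertions x ys)
    ≡⟨ ∑-insertions (λ π → F (y ∷ π)) x ys ⟩
  ∑ (λ (L , R) → F (y ∷ L ++ x ∷ R)) (splits ys)
    ≡⟨ sym (∑-map (λ (L , R) → F (L ++ x ∷ R)) (map₁ (y ∷_)) (splits ys)) ⟩
  ∑ (λ (L , R) → F (L ++ x ∷ R)) (map (map₁ (y ∷_)) (splits ys))
    ∎)

∑-insertions-map : (F : List A′ → ℤ) (φ : A → A′) (x : A) (l : List A) →
                   ∑ F (insertions (φ x) (map φ l)) ≡ ∑ (λ π → F (map φ π)) (insertions x l)
∑-insertions-map F φ x []       = refl
∑-insertions-map F φ x (y ∷ ys) = cong (_+_ (F (φ x ∷ φ y ∷ map φ ys))) (begin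
  ∑ F (map (φ y ∷_) (insertions (φ x) (map φ ys)))
    ≡⟨ ∑-map F (φ y ∷_) (insertions (φ x) (map φ ys)) ⟩
  ∑ (λ π → F (φ y ∷ π)) (insertions (φ x) (map φ ys))
    ≡⟨ ∑-insertions-map (λ π → F (φ y ∷ π)) φ x ys ⟩
  ∑ (λ π → F (φ y ∷ map φ π)) (insertions x ys)
    ≡⟨ sym (∑-map (λ π → F (map φ π)) (y ∷_) (insertions x ys)) ⟩
  ∑ (λ π → F (map φ π)) (map (y ∷_) (insertions x ys))
    ∎)

∑-splits-map : (G : List A′ × List A′ → ℤ) (φ : A → A′) (l : List A) →
               ∑ G (splits (map φ l)) ≡ ∑ (λ (L , R) → G (map φ L , map φ R)) (splits l)
∑-splits-map G φ []       = refl
∑-splits-map G φ (y ∷ ys) = cong (_+_ (G ([] , φ y ∷ map φ ys))) (begin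
  ∑ G (map (map₁ (φ y ∷_)) (splits (map φ ys)))
    ≡⟨ ∑-map G (map₁ (φ y ∷_)) (splits (map φ ys)) ⟩
  ∑ (λ (L , R) → G (φ y ∷ L , R)) (splits (map φ ys))
    ≡⟨ ∑-splits-map (λ (L , R) → G (φ y ∷ L , R)) φ ys ⟩
  ∑ (λ (L , R) → G (φ y ∷ map φ L , map φ R)) (splits ys)
    ≡⟨ sym (∑-map (λ (L , R) → G (map φ L , map φ R)) (map₁ (y ∷_)) (splits ys)) ⟩
  ∑ (λ (L , R) → G (map φ L , map φ R)) (map (map₁ (y ∷_)) (splits ys))
    ∎)

∑-splits-++ : (h : List A × List A → ℤ) (L : List A) (b : A) (R : List A) →
              ∑ h (splits (L ++ b ∷ R)) ≡
              ∑ (λ (P , Q) → h (P , Q ++ b ∷ R)) (splits L) + ∑ (λ (P , Q) → h (L ++ b ∷ P , Q)) (splits R)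
∑-splits-++ h [] b R =
  trans (cong (_+_ (h ([] , b ∷ R))) (∑-map h (map₁ (b ∷_)) (splits R)))
        (cong (_+ ∑ (λ (P , Q) → h (b ∷ P , Q)) (splits R)) (sym (ℤP.+-identityʳ (h ([] , b ∷ R)))))
∑-splits-++ h (l ∷ L) b R = begin
  h ([] , l ∷ L ++ b ∷ R) + ∑ h (map (map₁ (l ∷_)) (splits (L ++ b ∷ R)))
    ≡⟨ cong (_+_ (h ([] , l ∷ L ++ b ∷ R)))
            (trans (∑-map h (map₁ (l ∷_)) (splits (L ++ b ∷ R))) (∑-splits-++ (λ (P , Q) → h (l ∷ P , Q)) L b R)) ⟩
  h ([] , l ∷ L ++ b ∷ R) + (∑ (λ (P , Q) → h (l ∷ P , Q ++ b ∷ R)) (splits L) + right)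
    ≡⟨ sym (ℤP.+-assoc (h ([] , l ∷ L ++ b ∷ R)) _ right) ⟩
  h ([] , l ∷ L ++ b ∷ R) + ∑ (λ (P , Q) → h (l ∷ P , Q ++ b ∷ R)) (splits L) + right
    ≡⟨ cong (λ u → h ([] , l ∷ L ++ b ∷ R) + u + right)
            (sym (∑-map (λ (P , Q) → h (P , Q ++ b ∷ R)) (map₁ (l ∷_)) (splits L))) ⟩
  h ([] , l ∷ L ++ b ∷ R) + ∑ (λ (P , Q) → h (P , Q ++ b ∷ R)) (map (map₁ (l ∷_)) (splits L)) + right
    ∎
  where
  right = ∑ (λ (P , Q) → h (l ∷ L ++ b ∷ P , Q)) (splits R)

∑₃ ∑₃′ : (List A → List A → List A → ℤ) → List A → ℤ
∑₃  F σ = ∑ (λ (PQ , S) → ∑ (λ (P , Q) → F P Q S) (splits PQ)) (splits σ)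
∑₃′ F σ = ∑ (λ (P , QS) → ∑ (λ (Q , S) → F P Q S) (splits QS)) (splits σ)

∑₃-cons : (F : List A → List A → List A → ℤ) (y : A) (σ : List A) →
          ∑₃ F (y ∷ σ) ≡
          F [] [] (y ∷ σ) + + 0 + (∑ (λ (Q , S) → F [] (y ∷ Q) S) (splits σ) + ∑₃ (λ P → F (y ∷ P)) σ)
∑₃-cons F y σ = cong (_+_ (F [] [] (y ∷ σ) + + 0)) (begin
  ∑ (λ (PQ , S) → ∑ (λ (P , Q) → F P Q S) (splits PQ)) (map (map₁ (y ∷_)) (splits σ))
    ≡⟨ ∑-map (λ (PQ , S) → ∑ (λ (P , Q) → F P Q S) (splits PQ)) (map₁ (y ∷_)) (splits σ) ⟩
  ∑ (λ (PQ , S) → F [] (y ∷ PQ) S + ∑ (λ (P , Q) → F P Q S) (map (map₁ (y ∷_)) (splits PQ))) (splits σ)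
    ≡⟨ ∑-cong (λ (PQ , S) → cong (_+_ (F [] (y ∷ PQ) S))
                (∑-map (λ (P , Q) → F P Q S) (map₁ (y ∷_)) (splits PQ))) (splits σ) ⟩
  ∑ (λ (PQ , S) → F [] (y ∷ PQ) S + ∑ (λ (P , Q) → F (y ∷ P) Q S) (splits PQ)) (splits σ)
    ≡⟨ ∑-+ (λ (PQ , S) → F [] (y ∷ PQ) S) _ (splits σ) ⟩
  ∑ (λ (Q , S) → F [] (y ∷ Q) S) (splits σ) + ∑₃ (λ P → F (y ∷ P)) σ
    ∎)

∑₃≡∑₃′ : (F : List A → List A → List A → ℤ) (σ : List A) → ∑₃ F σ ≡ ∑₃′ F σ
∑₃≡∑₃′ F []      = refl
∑₃≡∑₃′ F (y ∷ σ) = begin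
  ∑₃ F (y ∷ σ)
    ≡⟨ ∑₃-cons F y σ ⟩
  F [] [] (y ∷ σ) + + 0 + (head + ∑₃ F′ σ)
    ≡⟨ cong (λ u → F [] [] (y ∷ σ) + + 0 + (head + u)) (∑₃≡∑₃′ F′ σ) ⟩
  F [] [] (y ∷ σ) + + 0 + (head + ∑₃′ F′ σ)
    ≡⟨ solve 3 (λ a b c → a :+ con (+ 0) :+ (b :+ c) := a :+ b :+ c) refl (F [] [] (y ∷ σ)) head (∑₃′ F′ σ) ⟩
  F [] [] (y ∷ σ) + head + ∑₃′ F′ σ
    ≡⟨ sym (cong₂ _+_ (cong (_+_ (F [] [] (y ∷ σ))) (∑-map (λ (Q , S) → F [] Q S) (map₁ (y ∷_)) (splits σ)))
                      (∑-map (λ (P , QS) → ∑ (λ (Q , S) → F P Q S) (splits QS)) (map₁ (y ∷_)) (splits σ))) ⟩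
  ∑₃′ F (y ∷ σ)
    ∎
  where
  F′ : List _ → List _ → List _ → ℤ
  F′ P = F (y ∷ P)
  head = ∑ (λ (Q , S) → F [] (y ∷ Q) S) (splits σ)

∑₃-cong : {F G : List A → List A → List A → ℤ} → (∀ P Q S → F P Q S ≡ G P Q S) →
          (σ : List A) → ∑₃ F σ ≡ ∑₃ G σ
∑₃-cong F≗G σ = ∑-cong (λ (PQ , S) → ∑-cong (λ (P , Q) → F≗G P Q S) (splits PQ)) (splits σ)

∑₃′-cong : {F G : List A → List A → List A → ℤ} → (∀ P Q S → F P Q S ≡ G P Q S) →
           (σ : List A) → ∑₃′ F σ ≡ ∑₃′ G σ
∑₃′-cong F≗G σ = ∑-cong (λ (P , QS) → ∑-cong (λ (Q , S) → F≗G P Q S) (splits QS)) (splits σ)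

∑₃-+ : (F G : List A → List A → List A → ℤ) (σ : List A) →
       ∑₃ (λ P Q S → F P Q S + G P Q S) σ ≡ ∑₃ F σ + ∑₃ G σ
∑₃-+ F G σ = trans (∑-cong (λ (PQ , S) → ∑-+ (λ (P , Q) → F P Q S) (λ (P , Q) → G P Q S) (splits PQ)) (splits σ))
                   (∑-+ (λ (PQ , S) → ∑ (λ (P , Q) → F P Q S) (splits PQ)) _ (splits σ))

∑₃-zero : {F : List A → List A → List A → ℤ} {σ : List A} → All P σ →
          (∀ {X Y Z} → All P X → All P Y → All P Z → F X Y Z ≡ + 0) → ∑₃ F σ ≡ + 0
∑₃-zero {σ = σ} pσ F≡0 = ∑-zero (splits σ) λ (PQ , S) p∈ → let pPQ , pS = All-splits pσ p∈ in
  ∑-zero (splits PQ) λ (P , Q) q∈ → let pP , pQ = All-splits pPQ q∈ in F≡0 pP pQ pS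

∑₃-front : {F : List A → List A → List A → ℤ} {σ : List A} → All P σ →
           (∀ {y Q S} → P y → All P Q → All P S → F [] (y ∷ Q) S ≡ + 0) →
           (∀ {y X Q S} → P y → All P X → All P Q → All P S → F (y ∷ X) Q S ≡ + 0) →
           ∑₃ F σ ≡ F [] [] σ
∑₃-front {F = F} {[]}    _            _       _       = trans (ℤP.+-identityʳ _) (ℤP.+-identityʳ (F [] [] []))
∑₃-front {F = F} {y ∷ σ} (py ∷ pσ) middle≡0 first≡0 = begin
  ∑₃ F (y ∷ σ)
    ≡⟨ ∑₃-cons F y σ ⟩
  F [] [] (y ∷ σ) + + 0 + (∑ (λ (Q , S) → F [] (y ∷ Q) S) (splits σ) + ∑₃ (λ X → F (y ∷ X)) σ)
    ≡⟨ cong₂ (λ u v → u + (v + ∑₃ (λ X → F (y ∷ X)) σ)) (ℤP.+-identityʳ (F [] [] (y ∷ σ)))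
         (∑-zero (splits σ) λ (Q , S) p∈ → let pQ , pS = All-splits pσ p∈ in middle≡0 py pQ pS) ⟩
  F [] [] (y ∷ σ) + (+ 0 + ∑₃ (λ X → F (y ∷ X)) σ)
    ≡⟨ cong (λ u → F [] [] (y ∷ σ) + u) (trans (ℤP.+-identityˡ _) (∑₃-zero pσ (first≡0 py))) ⟩
  F [] [] (y ∷ σ) + + 0
    ≡⟨ ℤP.+-identityʳ _ ⟩
  F [] [] (y ∷ σ)
    ∎

∑-insertions² : (w : List A → ℤ) (a b : A) (σ : List A) →
                ∑ (λ τ → ∑ w (insertions a τ)) (insertions b σ) ≡
                ∑₃ (λ P Q S → w (P ++ a ∷ Q ++ b ∷ S) + w (P ++ b ∷ Q ++ a ∷ S)) σ
∑-insertions² w a b σ = begin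
  ∑ (λ τ → ∑ w (insertions a τ)) (insertions b σ)
    ≡⟨ ∑-insertions (λ τ → ∑ w (insertions a τ)) b σ ⟩
  ∑ (λ (L , R) → ∑ w (insertions a (L ++ b ∷ R))) (splits σ)
    ≡⟨ ∑-cong (λ (L , R) → trans (∑-insertions w a (L ++ b ∷ R))
                 (∑-splits-++ (λ (X , Y) → w (X ++ a ∷ Y)) L b R)) (splits σ) ⟩
  ∑ (λ (L , R) → ∑ (λ (P , Q) → w (P ++ a ∷ Q ++ b ∷ R)) (splits L)
               + ∑ (λ (P , Q) → w ((L ++ b ∷ P) ++ a ∷ Q)) (splits R)) (splits σ)
    ≡⟨ ∑-+ (λ (L , R) → ∑ (λ (P , Q) → w (P ++ a ∷ Q ++ b ∷ R)) (splits L)) _ (splits σ) ⟩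
  ∑₃ (λ P Q S → w (P ++ a ∷ Q ++ b ∷ S)) σ + ∑₃′ (λ P Q S → w ((P ++ b ∷ Q) ++ a ∷ S)) σ
    ≡⟨ cong (_+_ (∑₃ (λ P Q S → w (P ++ a ∷ Q ++ b ∷ S)) σ))
            (trans (∑₃′-cong (λ P Q S → cong w (++-assoc P (b ∷ Q) (a ∷ S))) σ) (sym (∑₃≡∑₃′ _ σ))) ⟩
  ∑₃ (λ P Q S → w (P ++ a ∷ Q ++ b ∷ S)) σ + ∑₃ (λ P Q S → w (P ++ b ∷ Q ++ a ∷ S)) σ
    ≡⟨ sym (∑₃-+ (λ P Q S → w (P ++ a ∷ Q ++ b ∷ S)) (λ P Q S → w (P ++ b ∷ Q ++ a ∷ S)) σ) ⟩
  ∑₃ (λ P Q S → w (P ++ a ∷ Q ++ b ∷ S) + w (P ++ b ∷ Q ++ a ∷ S)) σ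
    ∎

∑-insertions-comm : (w : List A → ℤ) (a b : A) (σ : List A) →
                    ∑ (λ τ → ∑ w (insertions a τ)) (insertions b σ) ≡
                    ∑ (λ τ → ∑ w (insertions b τ)) (insertions a σ)
∑-insertions-comm w a b σ = trans (∑-insertions² w a b σ)
  (trans (∑₃-cong (λ P Q S → ℤP.+-comm (w (P ++ a ∷ Q ++ b ∷ S)) _) σ) (sym (∑-insertions² w b a σ)))

∑-insertions-splits : (H : List A × List A → ℤ) (x : A) (ρ : List A) →
                      ∑ (λ π → ∑ H (splits π)) (insertions x ρ) ≡
                      ∑ (λ (L , R) → ∑ (λ L′ → H (L′ , R)) (insertions x L) + ∑ (λ R′ → H (L , R′)) (insertions x R))
                        (splits ρ)
∑-insertions-splits H x ρ = begin
  ∑ (λ π → ∑ H (splits π)) (insertions x ρ)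
    ≡⟨ ∑-insertions (λ π → ∑ H (splits π)) x ρ ⟩
  ∑ (λ (P , S) → ∑ H (splits (P ++ x ∷ S))) (splits ρ)
    ≡⟨ trans (∑-cong (λ (P , S) → ∑-splits-++ H P x S) (splits ρ)) (∑-+ _ _ (splits ρ)) ⟩
  ∑₃ (λ L R S → H (L , R ++ x ∷ S)) ρ + ∑₃′ (λ P L R → H (P ++ x ∷ L , R)) ρ
    ≡⟨ ℤP.+-comm (∑₃ (λ L R S → H (L , R ++ x ∷ S)) ρ) _ ⟩
  ∑₃′ (λ P L R → H (P ++ x ∷ L , R)) ρ + ∑₃ (λ L R S → H (L , R ++ x ∷ S)) ρ
    ≡⟨ cong₂ _+_ (sym (∑₃≡∑₃′ (λ P L R → H (P ++ x ∷ L , R)) ρ))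
                 (∑₃≡∑₃′ (λ L R S → H (L , R ++ x ∷ S)) ρ) ⟩
  ∑₃ (λ P Q R → H (P ++ x ∷ Q , R)) ρ + ∑₃′ (λ L P Q → H (L , P ++ x ∷ Q)) ρ
    ≡⟨ sym (trans (∑-+ _ _ (splits ρ)) (cong₂ _+_
         (∑-cong (λ (L , R) → ∑-insertions (λ L′ → H (L′ , R)) x L) (splits ρ))
         (∑-cong (λ (L , R) → ∑-insertions (λ R′ → H (L , R′)) x R) (splits ρ)))) ⟩
  ∑ (λ (L , R) → ∑ (λ L′ → H (L′ , R)) (insertions x L) + ∑ (λ R′ → H (L , R′)) (insertions x R)) (splits ρ)
    ∎

act : (ℕ → ℕ) → ℤ → ℤ
act h (+ zero)  = + zero
act h (+ suc n) = + suc (h n)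
act h -[1+ n ]  = -[1+ h n ]

shift : List ℤ → List ℤ
shift = map (act suc)

ins± : ℕ → (List ℤ → ℤ) → List ℤ → ℤ
ins± k f σ = ∑ f (insertions (+ k) σ) + ∑ f (insertions (- + k) σ)

∑B : (List ℤ → ℤ) → Seq
∑B f n = ∑ f (B n)

∑-perms-map : (F : List A′ → ℤ) (φ : A → A′) (l : List A) →
              ∑ F (perms (map φ l)) ≡ ∑ (λ π → F (map φ π)) (perms l)
∑-perms-map F φ []      = refl
∑-perms-map F φ (x ∷ l) = begin
  ∑ F (concatMap (insertions (φ x)) (perms (map φ l)))
    ≡⟨ ∑-concatMap F (insertions (φ x)) (perms (map φ l)) ⟩
  ∑ (λ π → ∑ F (insertions (φ x) π)) (perms (map φ l))
    ≡⟨ ∑-perms-map (λ π → ∑ F (insertions (φ x) π)) φ l ⟩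
  ∑ (λ π → ∑ F (insertions (φ x) (map φ π))) (perms l)
    ≡⟨ ∑-cong (∑-insertions-map F φ x) (perms l) ⟩
  ∑ (λ π → ∑ (λ π′ → F (map φ π′)) (insertions x π)) (perms l)
    ≡⟨ sym (∑-concatMap (λ π → F (map φ π)) (insertions x) (perms l)) ⟩
  ∑ (λ π → F (map φ π)) (concatMap (insertions x) (perms l))
    ∎

∑-signings-cons : (F : List ℤ → ℤ) (k : ℕ) (ks : List ℕ) →
                  ∑ F (signings (k ∷ ks)) ≡ ∑ (λ s → F (+ k ∷ s) + F (- + k ∷ s)) (signings ks)
∑-signings-cons F k ks = trans (∑-concatMap F (λ s → (+ k ∷ s) ∷ (- + k ∷ s) ∷ []) (signings ks))
  (∑-cong (λ s → cong (_+_ (F (+ k ∷ s))) (ℤP.+-identityʳ (F (- + k ∷ s)))) (signings ks))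

ins±-cons : (k : ℕ) (F : List ℤ → ℤ) (y : ℤ) (s : List ℤ) →
            ins± k F (y ∷ s) ≡ (F (+ k ∷ y ∷ s) + F (- + k ∷ y ∷ s)) + ins± k (λ π → F (y ∷ π)) s
ins±-cons k F y s = trans
  (cong₂ (λ u v → F (+ k ∷ y ∷ s) + u + (F (- + k ∷ y ∷ s) + v))
         (∑-map F (y ∷_) (insertions (+ k) s)) (∑-map F (y ∷_) (insertions (- + k) s)))
  (ℤ+.interchange (F (+ k ∷ y ∷ s)) _ (F (- + k ∷ y ∷ s)) _)

ins±-+ : (k : ℕ) (F G : List ℤ → ℤ) (s : List ℤ) → ins± k (λ π → F π + G π) s ≡ ins± k F s + ins± k G s
ins±-+ k F G s = trans (cong₂ _+_ (∑-+ F G (insertions (+ k) s)) (∑-+ F G (insertions (- + k) s)))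
                       (ℤ+.interchange (∑ F (insertions (+ k) s)) _ _ _)

∑-signings-insertions : (F : List ℤ → ℤ) (k : ℕ) (l : List ℕ) →
                        ∑ (λ r → ∑ F (signings r)) (insertions k l) ≡ ∑ (ins± k F) (signings l)
∑-signings-insertions F k [] =
  solve 2 (λ a b → a :+ (b :+ con (+ 0)) :+ con (+ 0) := (a :+ con (+ 0)) :+ (b :+ con (+ 0)) :+ con (+ 0))
          refl (F (+ k ∷ [])) (F (- + k ∷ []))
∑-signings-insertions F k (y ∷ ys) = begin
  ∑ F (signings (k ∷ y ∷ ys)) + ∑ (λ r → ∑ F (signings r)) (map (y ∷_) (insertions k ys))
    ≡⟨ cong₂ _+_ (trans (∑-signings-cons F k (y ∷ ys)) (∑-signings-cons F′ y ys))
                 (trans (∑-map (λ r → ∑ F (signings r)) (y ∷_) (insertions k ys))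
                 (trans (∑-cong (λ r → ∑-signings-cons F y r) (insertions k ys))
                        (∑-signings-insertions G k ys))) ⟩
  ∑ X (signings ys) + ∑ (ins± k G) (signings ys)
    ≡⟨ sym (∑-+ X (ins± k G) (signings ys)) ⟩
  ∑ (λ s → X s + ins± k G s) (signings ys)
    ≡⟨ ∑-cong regroup (signings ys) ⟩
  ∑ (λ s → ins± k F (+ y ∷ s) + ins± k F (- + y ∷ s)) (signings ys)
    ≡⟨ sym (∑-signings-cons (ins± k F) y ys) ⟩
  ∑ (ins± k F) (signings (y ∷ ys))
    ∎
  where
  F′ G X : List ℤ → ℤ
  F′ s = F (+ k ∷ s) + F (- + k ∷ s)
  G  s = F (+ y ∷ s) + F (- + y ∷ s)
  X  s = F′ (+ y ∷ s) + F′ (- + y ∷ s)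
  regroup : ∀ s → X s + ins± k G s ≡ ins± k F (+ y ∷ s) + ins± k F (- + y ∷ s)
  regroup s = begin
    X s + ins± k G s
      ≡⟨ cong (_+_ (X s)) (ins±-+ k (λ π → F (+ y ∷ π)) (λ π → F (- + y ∷ π)) s) ⟩
    X s + (ins± k (λ π → F (+ y ∷ π)) s + ins± k (λ π → F (- + y ∷ π)) s)
      ≡⟨ ℤ+.interchange (F′ (+ y ∷ s)) (F′ (- + y ∷ s)) _ _ ⟩
    (F′ (+ y ∷ s) + ins± k (λ π → F (+ y ∷ π)) s) + (F′ (- + y ∷ s) + ins± k (λ π → F (- + y ∷ π)) s)
      ≡⟨ sym (cong₂ _+_ (ins±-cons k F (+ y) s) (ins±-cons k F (- + y) s)) ⟩
    ins± k F (+ y ∷ s) + ins± k F (- + y ∷ s)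
      ∎

∑-signings-shift : (F : List ℤ → ℤ) (p : List ℕ) →
                   ∑ F (signings (map suc (map suc p))) ≡ ∑ (λ σ → F (shift σ)) (signings (map suc p))
∑-signings-shift F []      = refl
∑-signings-shift F (a ∷ p) = begin
  ∑ F (signings (suc (suc a) ∷ map suc (map suc p)))
    ≡⟨ ∑-signings-cons F (suc (suc a)) (map suc (map suc p)) ⟩
  ∑ (λ s → F (+ suc (suc a) ∷ s) + F (-[1+ suc a ] ∷ s)) (signings (map suc (map suc p)))
    ≡⟨ ∑-signings-shift (λ s → F (+ suc (suc a) ∷ s) + F (-[1+ suc a ] ∷ s)) p ⟩
  ∑ (λ s → F (shift (+ suc a ∷ s)) + F (shift (-[1+ a ] ∷ s))) (signings (map suc p))
    ≡⟨ sym (∑-signings-cons (λ σ → F (shift σ)) (suc a) (map suc p)) ⟩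
  ∑ (λ σ → F (shift σ)) (signings (suc a ∷ map suc p))
    ∎

-- Every signed permutation of [n+1] arises exactly once by inserting ±1 into shift ρ with ρ ∈ 𝔅ₙ.
∑B-suc : (f : List ℤ → ℤ) (n : ℕ) → ∑B f (suc n) ≡ ∑B (λ ρ → ins± 1 f (shift ρ)) n
∑B-suc f n = begin
  ∑ f (concatMap signings (perms (1 ∷ map suc (applyUpTo suc n))))
    ≡⟨ cong (λ l → ∑ f (concatMap signings (perms (1 ∷ map suc l)))) (sym (map-upTo suc n)) ⟩
  ∑ f (concatMap signings (perms (1 ∷ map suc (map suc U))))
    ≡⟨ ∑-concatMap f signings (perms (1 ∷ map suc (map suc U))) ⟩
  ∑ (λ q → ∑ f (signings q)) (concatMap (insertions 1) (perms (map suc (map suc U))))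
    ≡⟨ ∑-concatMap (λ q → ∑ f (signings q)) (insertions 1) (perms (map suc (map suc U))) ⟩
  ∑ H (perms (map suc (map suc U)))
    ≡⟨ trans (∑-perms-map H suc (map suc U)) (∑-perms-map (λ p → H (map suc p)) suc U) ⟩
  ∑ (λ p → H (map suc (map suc p))) (perms U)
    ≡⟨ ∑-cong (λ p → trans (∑-signings-insertions f 1 (map suc (map suc p)))
                           (∑-signings-shift (ins± 1 f) p)) (perms U) ⟩
  ∑ (λ p → ∑ (λ ρ → ins± 1 f (shift ρ)) (signings (map suc p))) (perms U)
    ≡⟨ sym (∑-perms-map (λ q → ∑ (λ ρ → ins± 1 f (shift ρ)) (signings q)) suc U) ⟩
  ∑ (λ q → ∑ (λ ρ → ins± 1 f (shift ρ)) (signings q)) (perms (map suc U))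
    ≡⟨ sym (∑-concatMap (λ ρ → ins± 1 f (shift ρ)) signings (perms (map suc U))) ⟩
  ∑B (λ ρ → ins± 1 f (shift ρ)) n
    ∎
  where
  U = upTo n
  H : List ℕ → ℤ
  H p = ∑ (λ q → ∑ f (signings q)) (insertions 1 p)

data Entry (n : ℕ) : ℤ → Set where
  entry⁺ : ∀ {k} → k ℕ.< n → Entry n (+ suc k)
  entry⁻ : ∀ {k} → k ℕ.< n → Entry n -[1+ k ]

All-Entry-shift : {n : ℕ} {ρ : List ℤ} → All (Entry n) ρ → All (Entry (suc n)) (shift ρ)
All-Entry-shift []                  = []
All-Entry-shift (entry⁺ k<n ∷ ρ∈) = entry⁺ (s≤s k<n) ∷ All-Entry-shift ρ∈
All-Entry-shift (entry⁻ k<n ∷ ρ∈) = entry⁻ (s≤s k<n) ∷ All-Entry-shift ρ∈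

∑B-cong : (n : ℕ) {f g : List ℤ → ℤ} → (∀ σ → All (Entry n) σ → f σ ≡ g σ) → ∑B f n ≡ ∑B g n
∑B-cong zero    f≗g = cong (_+ + 0) (f≗g [] [])
∑B-cong (suc n) {f} {g} f≗g = trans (∑B-suc f n) (trans (∑B-cong n ins±f≗ins±g) (sym (∑B-suc g n)))
  where
  on-insertions : ∀ {ρ} x → Entry (suc n) x → All (Entry n) ρ →
                  ∑ f (insertions x (shift ρ)) ≡ ∑ g (insertions x (shift ρ))
  on-insertions x x∈ ρ∈ = ∑-cong-∈ _ λ π π∈ → f≗g π (All-insertions x∈ (All-Entry-shift ρ∈) π∈)
  ins±f≗ins±g : ∀ ρ → All (Entry n) ρ → ins± 1 f (shift ρ) ≡ ins± 1 g (shift ρ)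
  ins±f≗ins±g ρ ρ∈ =
    cong₂ _+_ (on-insertions (+ 1) (entry⁺ (s≤s z≤n)) ρ∈) (on-insertions -[1+ 0 ] (entry⁻ (s≤s z≤n)) ρ∈)

act-neg : (h : ℕ → ℕ) (x : ℤ) → act h (- x) ≡ - act h x
act-neg h (+ zero)  = refl
act-neg h (+ suc n) = refl
act-neg h -[1+ n ]  = refl

∑B-neg : (f : List ℤ → ℤ) → ∑B (λ σ → f (map -_ σ)) ≗ ∑B f
∑B-neg f zero    = refl
∑B-neg f (suc n) = begin
  ∑B (λ σ → f (map -_ σ)) (suc n)                     ≡⟨ ∑B-suc (λ σ → f (map -_ σ)) n ⟩
  ∑B (λ ρ → ins± 1 (λ σ → f (map -_ σ)) (shift ρ)) n   ≡⟨ ∑-cong flip (B n) ⟩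
  ∑B (λ ρ → ins± 1 f (shift (map -_ ρ))) n             ≡⟨ ∑B-neg (λ ρ → ins± 1 f (shift ρ)) n ⟩
  ∑B (λ ρ → ins± 1 f (shift ρ)) n                      ≡⟨ sym (∑B-suc f n) ⟩
  ∑B f (suc n)                                         ∎
  where
  shift-neg : ∀ ρ → map -_ (shift ρ) ≡ shift (map -_ ρ)
  shift-neg []      = refl
  shift-neg (x ∷ ρ) = cong₂ _∷_ (sym (act-neg suc x)) (shift-neg ρ)
  flip : ∀ ρ → ins± 1 (λ σ → f (map -_ σ)) (shift ρ) ≡ ins± 1 f (shift (map -_ ρ))
  flip ρ = begin
    ∑ (λ σ → f (map -_ σ)) (insertions (+ 1) (shift ρ)) + ∑ (λ σ → f (map -_ σ)) (insertions -[1+ 0 ] (shift ρ))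
      ≡⟨ sym (cong₂ _+_ (∑-insertions-map f -_ (+ 1) (shift ρ)) (∑-insertions-map f -_ -[1+ 0 ] (shift ρ))) ⟩
    ∑ f (insertions -[1+ 0 ] (map -_ (shift ρ))) + ∑ f (insertions (+ 1) (map -_ (shift ρ)))
      ≡⟨ ℤP.+-comm (∑ f (insertions -[1+ 0 ] (map -_ (shift ρ)))) _ ⟩
    ins± 1 f (map -_ (shift ρ))
      ≡⟨ cong (ins± 1 f) (shift-neg ρ) ⟩
    ins± 1 f (shift (map -_ ρ))
      ∎

∑B-suc-max : (f : List ℤ → ℤ) (n : ℕ) → ∑B f (suc n) ≡ ∑B (ins± (suc n) f) n
∑B-suc-max f zero    = ∑B-suc f 0
∑B-suc-max f (suc n) = begin
  ∑B f (suc (suc n))                               ≡⟨ ∑B-suc f (suc n) ⟩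
  ∑B (λ ρ → ins± 1 f (shift ρ)) (suc n)            ≡⟨ ∑B-suc-max (λ ρ → ins± 1 f (shift ρ)) n ⟩
  ∑B (ins± (suc n) (λ ρ → ins± 1 f (shift ρ))) n   ≡⟨ ∑-cong commute (B n) ⟩
  ∑B (λ ρ → ins± 1 (ins± (suc (suc n)) f) (shift ρ)) n ≡⟨ sym (∑B-suc (ins± (suc (suc n)) f) n) ⟩
  ∑B (ins± (suc (suc n)) f) (suc n)                ∎
  where
  D : List ℤ → ℤ → ℤ → ℤ
  D σ a b = ∑ (λ τ → ∑ f (insertions b τ)) (insertions a σ)
  shifted : ∀ ρ x → ∑ (λ τ → ins± 1 f (shift τ)) (insertions x ρ) ≡
                    D (shift ρ) (act suc x) (+ 1) + D (shift ρ) (act suc x) -[1+ 0 ]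
  shifted ρ x = trans (sym (∑-insertions-map (ins± 1 f) (act suc) x ρ))
    (∑-+ (λ τ → ∑ f (insertions (+ 1) τ)) (λ τ → ∑ f (insertions -[1+ 0 ] τ)) (insertions (act suc x) (shift ρ)))
  commute : ∀ ρ → ins± (suc n) (λ τ → ins± 1 f (shift τ)) ρ ≡ ins± 1 (ins± (suc (suc n)) f) (shift ρ)
  commute ρ = begin
    ins± (suc n) (λ τ → ins± 1 f (shift τ)) ρ
      ≡⟨ cong₂ _+_ (shifted ρ (+ suc n)) (shifted ρ -[1+ n ]) ⟩
    (D σ N⁺ (+ 1) + D σ N⁺ -[1+ 0 ]) + (D σ N⁻ (+ 1) + D σ N⁻ -[1+ 0 ])
      ≡⟨ cong₂ _+_ (cong₂ _+_ (∑-insertions-comm f (+ 1) N⁺ σ) (∑-insertions-comm f -[1+ 0 ] N⁺ σ))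
                   (cong₂ _+_ (∑-insertions-comm f (+ 1) N⁻ σ) (∑-insertions-comm f -[1+ 0 ] N⁻ σ)) ⟩
    (D σ (+ 1) N⁺ + D σ -[1+ 0 ] N⁺) + (D σ (+ 1) N⁻ + D σ -[1+ 0 ] N⁻)
      ≡⟨ ℤ+.interchange (D σ (+ 1) N⁺) _ _ _ ⟩
    (D σ (+ 1) N⁺ + D σ (+ 1) N⁻) + (D σ -[1+ 0 ] N⁺ + D σ -[1+ 0 ] N⁻)
      ≡⟨ sym (cong₂ _+_ (∑-+ (insert N⁺) (insert N⁻) (insertions (+ 1) σ))
                        (∑-+ (insert N⁺) (insert N⁻) (insertions -[1+ 0 ] σ))) ⟩
    ins± 1 (ins± (suc (suc n)) f) σ
      ∎
    where
    σ = shift ρ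
    N⁺ = + suc (suc n)
    N⁻ = -[1+ suc n ]
    insert : ℤ → List ℤ → ℤ
    insert x τ = ∑ f (insertions x τ)

<ᵇ-≡ : {x y u v : ℤ} → (x ℤ.< y ⇔ u ℤ.< v) → (x <ᵇ y) ≡ (u <ᵇ v)
<ᵇ-≡ {x} {y} {u} {v} x<y⇔u<v =
  trans (isYes≗does (x ℤ.<? y)) (trans (does-⇔ x<y⇔u<v (x ℤ.<? y) (u ℤ.<? v)) (sym (isYes≗does (u ℤ.<? v))))

<ᵇ-true : {x y : ℤ} → x ℤ.< y → (x <ᵇ y) ≡ true
<ᵇ-true {x} {y} x<y = trans (isYes≗does (x ℤ.<? y)) (dec-true (x ℤ.<? y) x<y)

<ᵇ-false : {x y : ℤ} → ¬ (x ℤ.< y) → (x <ᵇ y) ≡ false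
<ᵇ-false {x} {y} x≮y = trans (isYes≗does (x ℤ.<? y)) (dec-false (x ℤ.<? y) x≮y)

record Relabelling : Set where
  field
    fun    : ℕ → ℕ
    strict : fun Preserves ℕ._<_ ⟶ ℕ._<_

  reflects : ∀ {m n} → fun m ℕ.< fun n → m ℕ.< n
  reflects {m} {n} fm<fn with ℕP.<-cmp m n
  ... | tri< m<n _ _ = m<n
  ... | tri≈ _ refl _ = ⊥-elim (ℕP.<-irrefl refl fm<fn)
  ... | tri> _ _ n<m = ⊥-elim (ℕP.<-asym fm<fn (strict n<m))

  act-<ᵇ : (x y : ℤ) → (act fun x <ᵇ act fun y) ≡ (x <ᵇ y)
  act-<ᵇ (+ zero)  (+ zero)  = refl
  act-<ᵇ (+ zero)  (+ suc n) = refl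
  act-<ᵇ (+ zero)  -[1+ n ]  = refl
  act-<ᵇ (+ suc m) (+ zero)  = refl
  act-<ᵇ (+ suc m) (+ suc n) = <ᵇ-≡ (mk⇔ (λ { (ℤ.+<+ (s≤s p)) → ℤ.+<+ (s≤s (reflects p)) })
                                         (λ { (ℤ.+<+ (s≤s p)) → ℤ.+<+ (s≤s (strict p)) }))
  act-<ᵇ (+ suc m) -[1+ n ]  = refl
  act-<ᵇ -[1+ m ]  (+ zero)  = refl
  act-<ᵇ -[1+ m ]  (+ suc n) = refl
  act-<ᵇ -[1+ m ]  -[1+ n ]  = <ᵇ-≡ (mk⇔ (λ { (ℤ.-<- p) → ℤ.-<- (reflects p) })
                                         (λ { (ℤ.-<- p) → ℤ.-<- (strict p) }))

  relabel : List ℤ → List ℤ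
  relabel = map (act fun)

  mutual
    upFrom-relabel : (t : ℤ) (σ : List ℤ) → upFrom (act fun t) (relabel σ) ≡ upFrom t σ
    upFrom-relabel t []      = refl
    upFrom-relabel t (y ∷ σ) = cong₂ _∧_ (act-<ᵇ t y) (downFrom-relabel y σ)

    downFrom-relabel : (t : ℤ) (σ : List ℤ) → downFrom (act fun t) (relabel σ) ≡ downFrom t σ
    downFrom-relabel t []      = refl
    downFrom-relabel t (y ∷ σ) = cong₂ _∧_ (act-<ᵇ y t) (upFrom-relabel y σ)

  count<-relabel : (x : ℤ) (σ : List ℤ) → count (_<ᵇ act fun x) (relabel σ) ≡ count (_<ᵇ x) σ
  count<-relabel x []      = refl
  count<-relabel x (y ∷ σ) rewrite act-<ᵇ y x | count<-relabel x σ = refl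

  isSnake-relabel : (σ : List ℤ) → isSnake (relabel σ) ≡ isSnake σ
  isSnake-relabel = upFrom-relabel (+ 0)

  neg-relabel : (σ : List ℤ) → neg (relabel σ) ≡ neg σ
  neg-relabel = count<-relabel (+ 0)

  invD-relabel : (σ : List ℤ) → invD (relabel σ) ≡ invD σ
  invD-relabel []      = refl
  invD-relabel (x ∷ σ) = cong₂ ℕ._+_
    (cong₂ ℕ._+_ (count<-relabel x σ)
                 (trans (cong (λ z → count (_<ᵇ z) (relabel σ)) (sym (act-neg fun x))) (count<-relabel (- x) σ)))
    (invD-relabel σ)

open Relabelling public

lift : (ℕ → ℕ) → ℕ → ℕ
lift h zero    = zero
lift h (suc n) = suc (h n)

sucᴿ : Relabelling
sucᴿ = record { fun = suc ; strict = s≤s }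

liftᴿ : Relabelling → Relabelling
liftᴿ M = record { fun = lift (fun M) ; strict = lift-strict }
  where
  lift-strict : lift (fun M) Preserves ℕ._<_ ⟶ ℕ._<_
  lift-strict {zero}  {suc n} _       = s≤s z≤n
  lift-strict {suc m} {suc n} (s≤s p) = s≤s (strict M p)

shift-relabel : (M : Relabelling) (σ : List ℤ) → shift (relabel M σ) ≡ relabel (liftᴿ M) (shift σ)
shift-relabel M []               = refl
shift-relabel M (+ zero ∷ σ)     = cong (_ ∷_) (shift-relabel M σ)
shift-relabel M (+ suc x ∷ σ)    = cong (_ ∷_) (shift-relabel M σ)
shift-relabel M (-[1+ x ] ∷ σ)   = cong (_ ∷_) (shift-relabel M σ)

-- f sees only the signs and the relative order of the absolute values, so ∑B f n is also its sum
-- over the signed permutations of any n-element set of absolute values.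
Invariant : (List ℤ → ℤ) → Set
Invariant f = (M : Relabelling) (σ : List ℤ) → f (relabel M σ) ≡ f σ

Invariant-shift : {f : List ℤ → ℤ} → Invariant f → Invariant (λ σ → f (shift σ))
Invariant-shift {f} inv M σ = trans (cong f (shift-relabel M σ)) (inv (liftᴿ M) (shift σ))

Invariant-ins±1 : {f : List ℤ → ℤ} → Invariant f → Invariant (λ σ → ins± 1 f (shift σ))
Invariant-ins±1 {f} inv M σ = cong₂ _+_ (fixes (+ 1) refl) (fixes -[1+ 0 ] refl)
  where
  M′ = liftᴿ M
  fixes : (y : ℤ) → act (fun M′) y ≡ y →
          ∑ f (insertions y (shift (relabel M σ))) ≡ ∑ f (insertions y (shift σ))
  fixes y M′y≡y = begin
    ∑ f (insertions y (shift (relabel M σ)))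
      ≡⟨ cong (λ l → ∑ f (insertions y l)) (shift-relabel M σ) ⟩
    ∑ f (insertions y (relabel M′ (shift σ)))
      ≡⟨ cong (λ z → ∑ f (insertions z (relabel M′ (shift σ)))) (sym M′y≡y) ⟩
    ∑ f (insertions (act (fun M′) y) (relabel M′ (shift σ)))
      ≡⟨ ∑-insertions-map f (act (fun M′)) y (shift σ) ⟩
    ∑ (λ π → f (relabel M′ π)) (insertions y (shift σ))
      ≡⟨ ∑-cong (inv M′) (insertions y (shift σ)) ⟩
    ∑ f (insertions y (shift σ))
      ∎

∑B-shift : {f : List ℤ → ℤ} → Invariant f → ∑B (λ σ → f (shift σ)) ≗ ∑B f
∑B-shift inv n = ∑-cong (inv sucᴿ) (B n)

splitProduct : (List ℤ → ℤ) → (List ℤ → ℤ) → List ℤ → ℤ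
splitProduct f g π = ∑ (λ (L , R) → f L * g R) (splits π)

splitProduct-shift : (f g : List ℤ → ℤ) (ρ : List ℤ) →
                     splitProduct f g (shift ρ) ≡ splitProduct (λ σ → f (shift σ)) (λ σ → g (shift σ)) ρ
splitProduct-shift f g = ∑-splits-map (λ (L , R) → f L * g R) (act suc)

ins±-splitProduct : (k : ℕ) (f g : List ℤ → ℤ) (σ : List ℤ) →
                    ins± k (splitProduct f g) σ ≡ splitProduct (ins± k f) g σ + splitProduct f (ins± k g) σ
ins±-splitProduct k f g σ = begin
  ins± k (splitProduct f g) σ
    ≡⟨ cong₂ _+_ (leibniz (+ k)) (leibniz (- + k)) ⟩
  ∑ (λ (L , R) → I⁺ L * g R + f L * I⁺′ R) (splits σ) + ∑ (λ (L , R) → I⁻ L * g R + f L * I⁻′ R) (splits σ)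
    ≡⟨ sym (∑-+ _ _ (splits σ)) ⟩
  ∑ (λ (L , R) → (I⁺ L * g R + f L * I⁺′ R) + (I⁻ L * g R + f L * I⁻′ R)) (splits σ)
    ≡⟨ ∑-cong (λ (L , R) → trans (ℤ+.interchange (I⁺ L * g R) _ _ _)
                 (cong₂ _+_ (sym (ℤP.*-distribʳ-+ (g R) (I⁺ L) (I⁻ L)))
                            (sym (ℤP.*-distribˡ-+ (f L) (I⁺′ R) (I⁻′ R)))))
              (splits σ) ⟩
  ∑ (λ (L , R) → ins± k f L * g R + f L * ins± k g R) (splits σ)
    ≡⟨ ∑-+ (λ (L , R) → ins± k f L * g R) _ (splits σ) ⟩
  splitProduct (ins± k f) g σ + splitProduct f (ins± k g) σ
    ∎
  where
  I⁺ I⁻ I⁺′ I⁻′ : List ℤ → ℤ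
  I⁺  L = ∑ f (insertions (+ k) L)
  I⁻  L = ∑ f (insertions (- + k) L)
  I⁺′ R = ∑ g (insertions (+ k) R)
  I⁻′ R = ∑ g (insertions (- + k) R)
  leibniz : (x : ℤ) → ∑ (splitProduct f g) (insertions x σ) ≡
            ∑ (λ (L , R) → ∑ f (insertions x L) * g R + f L * ∑ g (insertions x R)) (splits σ)
  leibniz x = trans (∑-insertions-splits (λ (L , R) → f L * g R) x σ)
    (∑-cong (λ (L , R) → cong₂ _+_ (∑-*ʳ (g R) f (insertions x L)) (∑-*ˡ (f L) g (insertions x R))) (splits σ))

-- Inserting ±1 obeys the Leibniz rule ins±-splitProduct, matching the Leibniz rule that defines ⋆.
∑B-splitProduct : {f g : List ℤ → ℤ} → Invariant f → Invariant g → ∑B (splitProduct f g) ≗ ∑B f ⋆ ∑B g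
∑B-splitProduct {f} {g} _ _ zero =
  solve 2 (λ a b → a :* b :+ con (+ 0) :+ con (+ 0) := (a :+ con (+ 0)) :* (b :+ con (+ 0))) refl (f []) (g [])
∑B-splitProduct {f} {g} invf invg (suc n) = begin
  ∑B (splitProduct f g) (suc n)
    ≡⟨ ∑B-suc (splitProduct f g) n ⟩
  ∑B (λ ρ → ins± 1 (splitProduct f g) (shift ρ)) n
    ≡⟨ ∑-cong (λ ρ → trans (ins±-splitProduct 1 f g (shift ρ))
                 (cong₂ _+_ (splitProduct-shift (ins± 1 f) g ρ) (splitProduct-shift f (ins± 1 g) ρ))) (B n) ⟩
  ∑B (λ ρ → splitProduct f′ (λ σ → g (shift σ)) ρ + splitProduct (λ σ → f (shift σ)) g′ ρ) n
    ≡⟨ ∑-+ (splitProduct f′ (λ σ → g (shift σ))) (splitProduct (λ σ → f (shift σ)) g′) (B n) ⟩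
  ∑B (splitProduct f′ (λ σ → g (shift σ))) n + ∑B (splitProduct (λ σ → f (shift σ)) g′) n
    ≡⟨ cong₂ _+_ (∑B-splitProduct (Invariant-ins±1 invf) (Invariant-shift invg) n)
                 (∑B-splitProduct (Invariant-shift invf) (Invariant-ins±1 invg) n) ⟩
  (∑B f′ ⋆ ∑B (λ σ → g (shift σ))) n + (∑B (λ σ → f (shift σ)) ⋆ ∑B g′) n
    ≡⟨ cong₂ _+_ (⋆-cong (λ k → sym (∑B-suc f k)) (∑B-shift invg) n)
                 (⋆-cong (∑B-shift invf) (λ k → sym (∑B-suc g k)) n) ⟩
  (∑B f ⋆ ∑B g) (suc n)
    ∎
  where
  f′ g′ : List ℤ → ℤ
  f′ ρ = ins± 1 f (shift ρ)
  g′ ρ = ins± 1 g (shift ρ)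

altUp altDown : List ℤ → Bool
altUp []      = true
altUp (r ∷ R) = upFrom r R
altDown []      = true
altDown (r ∷ R) = downFrom r R

evenLength : List ℤ → Bool
evenLength L = even (length L)

-- The comparisons with ±(n+1) that hold for 0 and for every entry of a signed permutation of [n].
record Within (n : ℕ) (x : ℤ) : Set where
  field
    x<max : (x <ᵇ + suc n) ≡ true
    max≮x : (+ suc n <ᵇ x) ≡ false
    min<x : (-[1+ n ] <ᵇ x) ≡ true
    x≮min : (x <ᵇ -[1+ n ]) ≡ false

open Within

Entry⇒Within : {n : ℕ} {x : ℤ} → Entry n x → Within n x
Entry⇒Within (entry⁺ k<n) = record
  { x<max = <ᵇ-true (ℤ.+<+ (s≤s k<n)) ; max≮x = <ᵇ-false (λ { (ℤ.+<+ (s≤s n<k)) → ℕP.<-asym k<n n<k })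
  ; min<x = refl ; x≮min = refl }
Entry⇒Within (entry⁻ k<n) = record
  { x<max = refl ; max≮x = refl
  ; min<x = <ᵇ-true (ℤ.-<- k<n) ; x≮min = <ᵇ-false (λ { (ℤ.-<- n<k) → ℕP.<-asym k<n n<k }) }

Within-0 : {n : ℕ} → Within n (+ 0)
Within-0 = record { x<max = refl ; max≮x = refl ; min<x = refl ; x≮min = refl }

All-splits-Within : {n : ℕ} {ρ : List ℤ} → All (Entry n) ρ → {p : List ℤ × List ℤ} → p ∈ splits ρ →
                    All (Within n) (proj₁ p) × All (Within n) (proj₂ p)
All-splits-Within ρ∈ p∈ = let L∈ , R∈ = All-splits ρ∈ p∈ in All.map Entry⇒Within L∈ , All.map Entry⇒Within R∈

module Extremes (n : ℕ) where

  N⁺ N⁻ : ℤ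
  N⁺ = + suc n
  N⁻ = -[1+ n ]

  downFrom-max : (R : List ℤ) → All (Within n) R → downFrom N⁺ R ≡ altUp R
  downFrom-max []      _           = refl
  downFrom-max (r ∷ R) (r∈ ∷ _) rewrite x<max r∈ = refl

  upFrom-min : (R : List ℤ) → All (Within n) R → upFrom N⁻ R ≡ altDown R
  upFrom-min []      _           = refl
  upFrom-min (r ∷ R) (r∈ ∷ _) rewrite min<x r∈ = refl

  mutual
    upFrom-++-max : (t : ℤ) (L R : List ℤ) → Within n t → All (Within n) L → All (Within n) R →
                    upFrom t (L ++ N⁺ ∷ R) ≡ upFrom t L ∧ (evenLength L ∧ altUp R)
    upFrom-++-max t []      R t∈ _          R∈ rewrite x<max t∈ = downFrom-max R R∈
    upFrom-++-max t (l ∷ L) R t∈ (l∈ ∷ L∈) R∈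
      rewrite downFrom-++-max l L R l∈ L∈ R∈ | even-suc (length L) = sym (∧-assoc (t <ᵇ l) (downFrom l L) _)

    downFrom-++-max : (t : ℤ) (L R : List ℤ) → Within n t → All (Within n) L → All (Within n) R →
                      downFrom t (L ++ N⁺ ∷ R) ≡ downFrom t L ∧ (not (evenLength L) ∧ altUp R)
    downFrom-++-max t []      R t∈ _          R∈ rewrite max≮x t∈ = refl
    downFrom-++-max t (l ∷ L) R t∈ (l∈ ∷ L∈) R∈
      rewrite upFrom-++-max l L R l∈ L∈ R∈ | even-suc (length L) | not-involutive (even (length L)) =
      sym (∧-assoc (l <ᵇ t) (upFrom l L) _)

  mutual
    upFrom-++-min : (t : ℤ) (L R : List ℤ) → Within n t → All (Within n) L → All (Within n) R →
                    upFrom t (L ++ N⁻ ∷ R) ≡ upFrom t L ∧ (not (evenLength L) ∧ altDown R)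
    upFrom-++-min t []      R t∈ _          R∈ rewrite x≮min t∈ = refl
    upFrom-++-min t (l ∷ L) R t∈ (l∈ ∷ L∈) R∈
      rewrite downFrom-++-min l L R l∈ L∈ R∈ | even-suc (length L) | not-involutive (even (length L)) =
      sym (∧-assoc (t <ᵇ l) (downFrom l L) _)

    downFrom-++-min : (t : ℤ) (L R : List ℤ) → Within n t → All (Within n) L → All (Within n) R →
                      downFrom t (L ++ N⁻ ∷ R) ≡ downFrom t L ∧ (evenLength L ∧ altDown R)
    downFrom-++-min t []      R t∈ _          R∈ rewrite min<x t∈ = upFrom-min R R∈
    downFrom-++-min t (l ∷ L) R t∈ (l∈ ∷ L∈) R∈
      rewrite upFrom-++-min l L R l∈ L∈ R∈ | even-suc (length L) = sym (∧-assoc (l <ᵇ t) (upFrom l L) _)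

InvariantBool : (List ℤ → Bool) → Set
InvariantBool p = (M : Relabelling) (σ : List ℤ) → p (relabel M σ) ≡ p σ

Invariant-𝟙 : {p : List ℤ → Bool} → InvariantBool p → Invariant (λ σ → 𝟙 (p σ))
Invariant-𝟙 inv M σ = cong 𝟙 (inv M σ)

InvariantBool-∧ : {p q : List ℤ → Bool} → InvariantBool p → InvariantBool q → InvariantBool (λ σ → p σ ∧ q σ)
InvariantBool-∧ invp invq M σ = cong₂ _∧_ (invp M σ) (invq M σ)

InvariantBool-not : {p : List ℤ → Bool} → InvariantBool p → InvariantBool (λ σ → not (p σ))
InvariantBool-not inv M σ = cong not (inv M σ)

isSnake-invariant : InvariantBool isSnake
isSnake-invariant M = isSnake-relabel M

evenLength-invariant : InvariantBool evenLength
evenLength-invariant M σ = cong even (length-map (act (fun M)) σ)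

altUp-invariant : InvariantBool altUp
altUp-invariant M []      = refl
altUp-invariant M (r ∷ R) = upFrom-relabel M r R

altDown-invariant : InvariantBool altDown
altDown-invariant M []      = refl
altDown-invariant M (r ∷ R) = downFrom-relabel M r R

mutual
  upFrom-neg : (t : ℤ) (σ : List ℤ) → upFrom (- t) (map -_ σ) ≡ downFrom t σ
  upFrom-neg t []      = refl
  upFrom-neg t (y ∷ σ) = cong₂ _∧_ (<ᵇ-≡ (mk⇔ ℤP.neg-cancel-< ℤP.neg-mono-<)) (downFrom-neg y σ)

  downFrom-neg : (t : ℤ) (σ : List ℤ) → downFrom (- t) (map -_ σ) ≡ upFrom t σ
  downFrom-neg t []      = refl
  downFrom-neg t (y ∷ σ) = cong₂ _∧_ (<ᵇ-≡ (mk⇔ ℤP.neg-cancel-< ℤP.neg-mono-<)) (upFrom-neg y σ)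

snakes altDowns : Seq
snakes   = ∑B (λ σ → 𝟙 (isSnake σ))
altDowns = ∑B (λ σ → 𝟙 (altDown σ))

∑B-altUp : ∑B (λ σ → 𝟙 (altUp σ)) ≗ altDowns
∑B-altUp n = trans (sym (∑B-neg (λ σ → 𝟙 (altUp σ))  n)) (∑-cong (cong 𝟙 ∘ altUp-neg) (B n))
  where
  altUp-neg : ∀ σ → altUp (map -_ σ) ≡ altDown σ
  altUp-neg []      = refl
  altUp-neg (r ∷ σ) = upFrom-neg r σ

∑B-split-parity : (p : List ℤ → Bool) →
                  ∑B (λ σ → 𝟙 (p σ ∧ evenLength σ)) ⊞ ∑B (λ σ → 𝟙 (p σ ∧ not (evenLength σ))) ≗ ∑B (λ σ → 𝟙 (p σ))
∑B-split-parity p n = trans (sym (∑-+ _ _ (B n))) (∑-cong (λ σ → 𝟙-∧-split (p σ) (evenLength σ)) (B n))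

-- Cut at the entry ±(n+1): a snake is L, n+1, R with L a snake of even length and R alternating
-- upwards first, or L, −(n+1), R with L a snake of odd length and R alternating downwards first.
snakes-suc : (n : ℕ) → snakes (suc n) ≡ (snakes ⋆ altDowns) n
snakes-suc n = begin
  snakes (suc n)
    ≡⟨ ∑B-suc-max (λ σ → 𝟙 (isSnake σ)) n ⟩
  ∑B (ins± (suc n) (λ σ → 𝟙 (isSnake σ))) n
    ≡⟨ ∑B-cong n split-at-max ⟩
  ∑B (λ ρ → splitProduct snakeᵉ up ρ + splitProduct snakeᵒ down ρ) n
    ≡⟨ ∑-+ (splitProduct snakeᵉ up) (splitProduct snakeᵒ down) (B n) ⟩
  ∑B (splitProduct snakeᵉ up) n + ∑B (splitProduct snakeᵒ down) n
    ≡⟨ cong₂ _+_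
         (∑B-splitProduct (Invariant-𝟙 (InvariantBool-∧ isSnake-invariant evenLength-invariant))
                          (Invariant-𝟙 altUp-invariant) n)
         (∑B-splitProduct (Invariant-𝟙 (InvariantBool-∧ isSnake-invariant (InvariantBool-not evenLength-invariant)))
                          (Invariant-𝟙 altDown-invariant) n) ⟩
  (∑B snakeᵉ ⋆ ∑B up) n + (∑B snakeᵒ ⋆ altDowns) n
    ≡⟨ cong (_+ (∑B snakeᵒ ⋆ altDowns) n) (⋆-congʳ (∑B snakeᵉ) ∑B-altUp n) ⟩
  (∑B snakeᵉ ⋆ altDowns ⊞ ∑B snakeᵒ ⋆ altDowns) n
    ≡⟨ sym (⋆-distribʳ-⊞ (∑B snakeᵉ) (∑B snakeᵒ) altDowns n) ⟩
  ((∑B snakeᵉ ⊞ ∑B snakeᵒ) ⋆ altDowns) n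
    ≡⟨ ⋆-congˡ altDowns (∑B-split-parity isSnake) n ⟩
  (snakes ⋆ altDowns) n
    ∎
  where
  open Extremes n
  snakeᵉ snakeᵒ up down : List ℤ → ℤ
  snakeᵉ L = 𝟙 (isSnake L ∧ evenLength L)
  snakeᵒ L = 𝟙 (isSnake L ∧ not (evenLength L))
  up     R = 𝟙 (altUp R)
  down   R = 𝟙 (altDown R)
  split-at-max : ∀ ρ → All (Entry n) ρ →
                 ins± (suc n) (λ σ → 𝟙 (isSnake σ)) ρ ≡ splitProduct snakeᵉ up ρ + splitProduct snakeᵒ down ρ
  split-at-max ρ ρ∈ = cong₂ _+_
    (trans (∑-insertions _ N⁺ ρ) (∑-cong-∈ (splits ρ) λ (L , R) p∈ → let L∈ , R∈ = All-splits-Within ρ∈ p∈ in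
       trans (cong 𝟙 (upFrom-++-max (+ 0) L R Within-0 L∈ R∈)) (𝟙-∧-∧ (isSnake L) (evenLength L) (altUp R))))
    (trans (∑-insertions _ N⁻ ρ) (∑-cong-∈ (splits ρ) λ (L , R) p∈ → let L∈ , R∈ = All-splits-Within ρ∈ p∈ in
       trans (cong 𝟙 (upFrom-++-min (+ 0) L R Within-0 L∈ R∈))
             (𝟙-∧-∧ (isSnake L) (not (evenLength L)) (altDown R))))

∑-splits-null : (ρ : List ℤ) → ∑ (λ (L , R) → 𝟙 (null L ∧ null R)) (splits ρ) ≡ 𝟙 (null ρ)
∑-splits-null []      = refl
∑-splits-null (y ∷ ρ) = trans (ℤP.+-identityˡ _)
  (trans (∑-map (λ (L , R) → 𝟙 (null L ∧ null R)) (map₁ (y ∷_)) (splits ρ)) (∑-zero (splits ρ) (λ _ _ → refl)))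

∑B-null : ∑B (λ σ → 𝟙 (null σ)) ≗ δ
∑B-null zero    = refl
∑B-null (suc n) = trans (∑B-suc (λ σ → 𝟙 (null σ)) n) (∑-zero (B n) λ ρ _ →
  cong₂ _+_ (nonempty (+ 1) (shift ρ)) (nonempty -[1+ 0 ] (shift ρ)))
  where
  nonempty : ∀ x σ → ∑ (λ π → 𝟙 (null π)) (insertions x σ) ≡ + 0
  nonempty x []      = refl
  nonempty x (y ∷ σ) = trans (ℤP.+-identityˡ _)
    (trans (∑-map (λ π → 𝟙 (null π)) (y ∷_) (insertions x σ)) (∑-zero (insertions x σ) (λ _ _ → refl)))

-- As for snakes, except that −(n+1) can come first only in the one-entry permutation −1.
altDowns-suc : (n : ℕ) → altDowns (suc n) ≡ (altDowns ⋆ altDowns ⊞ δ) n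
altDowns-suc n = begin
  altDowns (suc n)
    ≡⟨ ∑B-suc-max (λ σ → 𝟙 (altDown σ)) n ⟩
  ∑B (ins± (suc n) (λ σ → 𝟙 (altDown σ))) n
    ≡⟨ ∑B-cong n split-at-max ⟩
  ∑B (λ ρ → splitProduct altDownᵉ up ρ + (splitProduct altDownᵒ down ρ + 𝟙 (null ρ))) n
    ≡⟨ trans (∑-+ (splitProduct altDownᵉ up) _ (B n))
             (cong (_+_ (∑B (splitProduct altDownᵉ up) n)) (∑-+ (splitProduct altDownᵒ down) (λ σ → 𝟙 (null σ)) (B n))) ⟩
  ∑B (splitProduct altDownᵉ up) n + (∑B (splitProduct altDownᵒ down) n + ∑B (λ σ → 𝟙 (null σ)) n)
    ≡⟨ cong₂ _+_
         (trans (∑B-splitProduct (Invariant-𝟙 (InvariantBool-∧ altDown-invariant evenLength-invariant))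
                                 (Invariant-𝟙 altUp-invariant) n)
                (⋆-congʳ (∑B altDownᵉ) ∑B-altUp n))
         (cong₂ _+_ (∑B-splitProduct (Invariant-𝟙 (InvariantBool-∧ altDown-invariant (InvariantBool-not evenLength-invariant)))
                                     (Invariant-𝟙 altDown-invariant) n)
                    (∑B-null n)) ⟩
  (∑B altDownᵉ ⋆ altDowns) n + ((∑B altDownᵒ ⋆ altDowns) n + δ n)
    ≡⟨ sym (ℤP.+-assoc ((∑B altDownᵉ ⋆ altDowns) n) _ _) ⟩
  (∑B altDownᵉ ⋆ altDowns ⊞ ∑B altDownᵒ ⋆ altDowns ⊞ δ) n
    ≡⟨ cong (_+ δ n) (trans (sym (⋆-distribʳ-⊞ (∑B altDownᵉ) (∑B altDownᵒ) altDowns n))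
                            (⋆-congˡ altDowns (∑B-split-parity altDown) n)) ⟩
  (altDowns ⋆ altDowns ⊞ δ) n
    ∎
  where
  open Extremes n
  altDownᵉ altDownᵒ up down : List ℤ → ℤ
  altDownᵉ L = 𝟙 (altDown L ∧ evenLength L)
  altDownᵒ L = 𝟙 (altDown L ∧ not (evenLength L))
  up       R = 𝟙 (altUp R)
  down     R = 𝟙 (altDown R)
  max-inside : ∀ L R → All (Within n) L → All (Within n) R → 𝟙 (altDown (L ++ N⁺ ∷ R)) ≡ altDownᵉ L * up R
  max-inside []      R _          R∈ = trans (cong 𝟙 (downFrom-max R R∈)) (sym (ℤP.*-identityˡ _))
  max-inside (l ∷ L) R (l∈ ∷ L∈) R∈ rewrite downFrom-++-max l L R l∈ L∈ R∈ | even-suc (length L) =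
    𝟙-∧-∧ (downFrom l L) (not (evenLength L)) (altUp R)
  min-inside : ∀ L R → All (Within n) L → All (Within n) R →
               𝟙 (altDown (L ++ N⁻ ∷ R)) ≡ altDownᵒ L * down R + 𝟙 (null L ∧ null R)
  min-inside []      []      _ _          = refl
  min-inside []      (r ∷ R) _ (r∈ ∷ _) rewrite x≮min r∈ =
    sym (trans (ℤP.+-identityʳ _) (ℤP.*-zeroˡ (𝟙 (downFrom r R))))
  min-inside (l ∷ L) R (l∈ ∷ L∈) R∈
    rewrite downFrom-++-min l L R l∈ L∈ R∈ | even-suc (length L) | not-involutive (even (length L)) =
    trans (𝟙-∧-∧ (downFrom l L) (evenLength L) (altDown R)) (sym (ℤP.+-identityʳ _))
  split-at-max : ∀ ρ → All (Entry n) ρ → ins± (suc n) (λ σ → 𝟙 (altDown σ)) ρ ≡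
                 splitProduct altDownᵉ up ρ + (splitProduct altDownᵒ down ρ + 𝟙 (null ρ))
  split-at-max ρ ρ∈ = cong₂ _+_
    (trans (∑-insertions _ N⁺ ρ) (∑-cong-∈ (splits ρ) λ (L , R) p∈ → let L∈ , R∈ = All-splits-Within ρ∈ p∈ in
       max-inside L R L∈ R∈))
    (trans (∑-insertions _ N⁻ ρ) (trans (∑-cong-∈ (splits ρ) λ (L , R) p∈ → let L∈ , R∈ = All-splits-Within ρ∈ p∈ in
       min-inside L R L∈ R∈)
       (trans (∑-+ (λ (L , R) → altDownᵒ L * down R) _ (splits ρ))
              (cong (_+_ (splitProduct altDownᵒ down ρ)) (∑-splits-null ρ)))))

altDowns⋆[cos-sin] : altDowns ⋆ cos-sin ≗ cos+sin
altDowns⋆[cos-sin] n = ℤP.i-j≡0⇒i≡j _ _ (∂≗⋆-vanishes altDowns u refl ∂u≗Z⋆u n)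
  where
  Z = altDowns
  u : Seq
  u = Z ⋆ cos-sin ⊟ cos+sin
  ∂u≗Z⋆u : ∂ u ≗ Z ⋆ u
  ∂u≗Z⋆u n = begin
    (∂ Z ⋆ cos-sin) n + (Z ⋆ ∂ cos-sin) n - ∂ cos+sin n
      ≡⟨ cong₂ _-_ (cong₂ _+_ (trans (⋆-congˡ cos-sin altDowns-suc n) (⋆-distribʳ-⊞ (Z ⋆ Z) δ cos-sin n))
                              (trans (⋆-congʳ Z ∂[cos-sin] n) (⋆-negʳ Z cos+sin n)))
                   (∂[cos+sin] n) ⟩
    ((Z ⋆ Z) ⋆ cos-sin) n + (δ ⋆ cos-sin) n + - (Z ⋆ cos+sin) n - cos-sin n
      ≡⟨ cong₂ (λ a b → a + b + - (Z ⋆ cos+sin) n - cos-sin n) (⋆-assoc Z Z cos-sin n) (⋆-identityˡ cos-sin n) ⟩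
    (Z ⋆ (Z ⋆ cos-sin)) n + cos-sin n + - (Z ⋆ cos+sin) n - cos-sin n
      ≡⟨ solve 3 (λ a b c → a :+ b :+ :- c :- b := a :+ :- c) refl ((Z ⋆ (Z ⋆ cos-sin)) n) (cos-sin n) ((Z ⋆ cos+sin) n) ⟩
    (Z ⋆ (Z ⋆ cos-sin)) n + - (Z ⋆ cos+sin) n
      ≡⟨ sym (trans (⋆-distribˡ-⊞ Z (Z ⋆ cos-sin) (⊟ cos+sin) n) (cong (_+_ ((Z ⋆ (Z ⋆ cos-sin)) n)) (⋆-negʳ Z cos+sin n))) ⟩
    (Z ⋆ u) n
      ∎

snakes⋆[cos-sin] : snakes ⋆ cos-sin ≗ δ
snakes⋆[cos-sin] zero    = refl
snakes⋆[cos-sin] (suc n) = begin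
  (∂ snakes ⋆ cos-sin) n + (snakes ⋆ ∂ cos-sin) n
    ≡⟨ cong₂ _+_ (trans (⋆-congˡ cos-sin snakes-suc n) (⋆-assoc snakes altDowns cos-sin n))
                 (trans (⋆-congʳ snakes ∂[cos-sin] n) (⋆-negʳ snakes cos+sin n)) ⟩
  (snakes ⋆ (altDowns ⋆ cos-sin)) n + - (snakes ⋆ cos+sin) n
    ≡⟨ cong (_+ - (snakes ⋆ cos+sin) n) (⋆-congʳ snakes altDowns⋆[cos-sin] n) ⟩
  (snakes ⋆ cos+sin) n + - (snakes ⋆ cos+sin) n
    ≡⟨ ℤP.+-inverseʳ ((snakes ⋆ cos+sin) n) ⟩
  + 0
    ∎

Alike : ℤ → ℤ → ℤ → Set
Alike u x x′ = ((u <ᵇ x) ≡ (u <ᵇ x′)) × ((x <ᵇ u) ≡ (x′ <ᵇ u))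

AlikeHead : List ℤ → ℤ → ℤ → Set
AlikeHead []      x x′ = ⊤
AlikeHead (v ∷ _) x x′ = Alike v x x′

All-AlikeHead : {Q : ℤ → Set} → (∀ {v} → Q v → Alike v x x′) → {B : List ℤ} → All Q B → AlikeHead B x x′
All-AlikeHead alike []      = tt
All-AlikeHead alike (qv ∷ _) = alike qv

lastOr : ℤ → List ℤ → ℤ
lastOr t []      = t
lastOr t (a ∷ A) = lastOr a A

All-lastOr : {t : ℤ} {A : List ℤ} → P t → All P A → P (lastOr t A)
All-lastOr pt []         = pt
All-lastOr pt (pa ∷ pA) = All-lastOr pa pA

lastOr-++ : (t x : ℤ) (A B : List ℤ) → lastOr t (A ++ x ∷ B) ≡ lastOr x B
lastOr-++ t x []      B = refl
lastOr-++ t x (a ∷ A) B = lastOr-++ a x A B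

downFrom-replaceHead : (B : List ℤ) → AlikeHead B x x′ → downFrom x B ≡ downFrom x′ B
downFrom-replaceHead []      _            = refl
downFrom-replaceHead (v ∷ B) (v<x , _) = cong (_∧ upFrom v B) v<x

upFrom-replaceHead : (B : List ℤ) → AlikeHead B x x′ → upFrom x B ≡ upFrom x′ B
upFrom-replaceHead []      _            = refl
upFrom-replaceHead (v ∷ B) (_ , x<v) = cong (_∧ downFrom v B) x<v

mutual
  upFrom-replace : (t : ℤ) (A B : List ℤ) → Alike (lastOr t A) x x′ → AlikeHead B x x′ →
                   upFrom t (A ++ x ∷ B) ≡ upFrom t (A ++ x′ ∷ B)
  upFrom-replace t []      B (t<x , _) next = cong₂ _∧_ t<x (downFrom-replaceHead B next)
  upFrom-replace t (a ∷ A) B alike      next = cong ((t <ᵇ a) ∧_) (downFrom-replace a A B alike next)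

  downFrom-replace : (t : ℤ) (A B : List ℤ) → Alike (lastOr t A) x x′ → AlikeHead B x x′ →
                     downFrom t (A ++ x ∷ B) ≡ downFrom t (A ++ x′ ∷ B)
  downFrom-replace t []      B (_ , x<t) next = cong₂ _∧_ x<t (upFrom-replaceHead B next)
  downFrom-replace t (a ∷ A) B alike      next = cong ((a <ᵇ t) ∧_) (upFrom-replace a A B alike next)

data AtLeast2 : ℤ → Set where
  +≥2 : ∀ k → AtLeast2 (+ suc (suc k))
  -≥2 : ∀ k → AtLeast2 -[1+ suc k ]

AtLeast2-neg : {u : ℤ} → AtLeast2 u → AtLeast2 (- u)
AtLeast2-neg (+≥2 k) = -≥2 k
AtLeast2-neg (-≥2 k) = +≥2 k

AtLeast2-alike±1 : {u : ℤ} → AtLeast2 u → Alike u (+ 1) -[1+ 0 ]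
AtLeast2-alike±1 (+≥2 k) = refl , refl
AtLeast2-alike±1 (-≥2 k) = refl , refl

All-AtLeast2-shift : {n : ℕ} {ρ : List ℤ} → All (Entry n) ρ → All AtLeast2 (shift ρ)
All-AtLeast2-shift []                                = []
All-AtLeast2-shift (entry⁺ {k} _ ∷ ρ∈) = +≥2 k ∷ All-AtLeast2-shift ρ∈
All-AtLeast2-shift (entry⁻ {k} _ ∷ ρ∈) = -≥2 k ∷ All-AtLeast2-shift ρ∈

module _ (t y : ℤ) (L R : List ℤ) (y≥2 : AtLeast2 y) (L≥2 : All AtLeast2 L) (R≥2 : All AtLeast2 R) where

  upFrom-toggle±1 : upFrom t (y ∷ L ++ + 1 ∷ R) ≡ upFrom t (y ∷ L ++ -[1+ 0 ] ∷ R)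
  upFrom-toggle±1 = upFrom-replace t (y ∷ L) R (AtLeast2-alike±1 (All-lastOr y≥2 L≥2)) (All-AlikeHead AtLeast2-alike±1 R≥2)

  downFrom-toggle±1 : downFrom t (y ∷ L ++ + 1 ∷ R) ≡ downFrom t (y ∷ L ++ -[1+ 0 ] ∷ R)
  downFrom-toggle±1 = downFrom-replace t (y ∷ L) R (AtLeast2-alike±1 (All-lastOr y≥2 L≥2)) (All-AlikeHead AtLeast2-alike±1 R≥2)

invD-toggle±1 : (L R : List ℤ) → All AtLeast2 L → invD (L ++ + 1 ∷ R) ≡ invD (L ++ -[1+ 0 ] ∷ R)
invD-toggle±1 []      R _           = cong (ℕ._+ invD R) (ℕP.+-comm (count (_<ᵇ + 1) R) _)
invD-toggle±1 (l ∷ L) R (l≥2 ∷ L≥2) = cong₂ ℕ._+_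
  (cong₂ ℕ._+_ (count-replace (_<ᵇ l) L R (proj₂ (AtLeast2-alike±1 l≥2)))
               (count-replace (_<ᵇ - l) L R (proj₂ (AtLeast2-alike±1 (AtLeast2-neg l≥2)))))
  (invD-toggle±1 L R L≥2)

inD-toggle±1 : (L R : List ℤ) → inD (L ++ -[1+ 0 ] ∷ R) ≡ not (inD (L ++ + 1 ∷ R))
inD-toggle±1 L R = trans (cong even (trans (count-++ (_<ᵇ + 0) L (-[1+ 0 ] ∷ R))
                                           (trans (ℕP.+-suc (neg L) (neg R)) (cong suc (sym (count-++ (_<ᵇ + 0) L (+ 1 ∷ R)))))))
                         (even-suc (neg (L ++ + 1 ∷ R)))

ins±1-head : (w : List ℤ → ℤ) →
             (∀ {y L R} → AtLeast2 y → All AtLeast2 L → All AtLeast2 R →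
                w (y ∷ L ++ + 1 ∷ R) + w (y ∷ L ++ -[1+ 0 ] ∷ R) ≡ + 0) →
             {σ : List ℤ} → All AtLeast2 σ → ins± 1 w σ ≡ w (+ 1 ∷ σ) + w (-[1+ 0 ] ∷ σ)
ins±1-head w cancels []          = cong₂ _+_ (ℤP.+-identityʳ (w (+ 1 ∷ []))) (ℤP.+-identityʳ (w (-[1+ 0 ] ∷ [])))
ins±1-head w cancels {y ∷ σ} (y≥2 ∷ σ≥2) = begin
  ins± 1 w (y ∷ σ)
    ≡⟨ ins±-cons 1 w y σ ⟩
  w (+ 1 ∷ y ∷ σ) + w (-[1+ 0 ] ∷ y ∷ σ) + ins± 1 (λ π → w (y ∷ π)) σ
    ≡⟨ cong (_+_ (w (+ 1 ∷ y ∷ σ) + w (-[1+ 0 ] ∷ y ∷ σ))) inner-cancel ⟩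
  w (+ 1 ∷ y ∷ σ) + w (-[1+ 0 ] ∷ y ∷ σ) + + 0
    ≡⟨ ℤP.+-identityʳ _ ⟩
  w (+ 1 ∷ y ∷ σ) + w (-[1+ 0 ] ∷ y ∷ σ)
    ∎
  where
  inner-cancel : ins± 1 (λ π → w (y ∷ π)) σ ≡ + 0
  inner-cancel = trans (cong₂ _+_ (∑-insertions (λ π → w (y ∷ π)) (+ 1) σ) (∑-insertions (λ π → w (y ∷ π)) -[1+ 0 ] σ))
    (trans (sym (∑-+ _ _ (splits σ)))
           (∑-zero (splits σ) λ (L , R) p∈ → let L≥2 , R≥2 = All-splits σ≥2 p∈ in cancels y≥2 L≥2 R≥2))

module _ {n : ℕ} {ρ : List ℤ} (ρ∈ : All (Entry n) ρ) where

  count-shift : (y : ℤ) → (∀ {x} → Entry n x → (act suc x <ᵇ y) ≡ (x <ᵇ + 0)) → count (_<ᵇ y) (shift ρ) ≡ neg ρ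
  count-shift y below = trans (count-map (_<ᵇ y) (act suc) ρ) (count-cong-All below ρ∈)

  count<1-shift : count (_<ᵇ + 1) (shift ρ) ≡ neg ρ
  count<1-shift = count-shift (+ 1) λ { (entry⁺ _) → refl ; (entry⁻ _) → refl }

  count<-1-shift : count (_<ᵇ -[1+ 0 ]) (shift ρ) ≡ neg ρ
  count<-1-shift = count-shift -[1+ 0 ] λ { (entry⁺ _) → refl ; (entry⁻ _) → refl }

  invD-±1∷shift : (e : ℤ) → count (_<ᵇ e) (shift ρ) ≡ neg ρ → count (_<ᵇ - e) (shift ρ) ≡ neg ρ →
                  invD (e ∷ shift ρ) ≡ neg ρ ℕ.+ neg ρ ℕ.+ invD ρ
  invD-±1∷shift e below-e below-−e = cong₂ ℕ._+_ (cong₂ ℕ._+_ below-e below-−e) (invD-relabel sucᴿ ρ)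

downFrom-1-shift : {n : ℕ} {ρ : List ℤ} → All (Entry n) ρ → downFrom (+ 1) (shift ρ) ≡ downFrom (+ 0) ρ
downFrom-1-shift []                       = refl
downFrom-1-shift (entry⁺ _ ∷ _)           = refl
downFrom-1-shift {ρ = r ∷ σ} (entry⁻ _ ∷ _) = upFrom-relabel sucᴿ r σ

upFrom-−1-shift : {n : ℕ} {ρ : List ℤ} → All (Entry n) ρ → upFrom -[1+ 0 ] (shift ρ) ≡ upFrom (+ 0) ρ
upFrom-−1-shift []                       = refl
upFrom-−1-shift {ρ = r ∷ σ} (entry⁺ _ ∷ _) = downFrom-relabel sucᴿ r σ
upFrom-−1-shift (entry⁻ _ ∷ _)           = refl

-- Changing the sign of the entry ±1, unless it comes first, keeps the alternation pattern and invD
-- but changes the parity of neg; for ±1 in front, invD (±1 ∷ shift ρ) = 2 neg ρ + invD ρ.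
module SignedByNegatives (c : ℕ → ℤ) (c-parity : ∀ a m → c (a ℕ.+ a ℕ.+ m) ≡ c m) where

  weight : (List ℤ → Bool) → List ℤ → ℤ
  weight alt π = 𝟙 (alt π) * c (invD π) * sign (inD π)

  snakeSum downSum : Seq
  snakeSum = ∑B (weight isSnake)
  downSum  = ∑B (weight (downFrom (+ 0)))

  weight-cancels : (alt : List ℤ → Bool) {y : ℤ} {L R : List ℤ} → AtLeast2 y → All AtLeast2 L →
                   alt (y ∷ L ++ + 1 ∷ R) ≡ alt (y ∷ L ++ -[1+ 0 ] ∷ R) →
                   weight alt (y ∷ L ++ + 1 ∷ R) + weight alt (y ∷ L ++ -[1+ 0 ] ∷ R) ≡ + 0
  weight-cancels alt {y} {L} {R} y≥2 L≥2 same-alt = begin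
    weight alt π⁺ + weight alt π⁻
      ≡⟨ cong (_+_ (weight alt π⁺)) (cong₂ _*_
           (cong₂ _*_ (cong 𝟙 (sym same-alt)) (cong c (sym (invD-toggle±1 (y ∷ L) R (y≥2 ∷ L≥2)))))
           (cong sign (inD-toggle±1 (y ∷ L) R))) ⟩
    s * sign (inD π⁺) + s * sign (not (inD π⁺))
      ≡⟨ s*sign+s*sign-not s (inD π⁺) ⟩
    + 0
      ∎
    where
    π⁺ = y ∷ L ++ + 1 ∷ R
    π⁻ = y ∷ L ++ -[1+ 0 ] ∷ R
    s = 𝟙 (alt π⁺) * c (invD π⁺)

  snakeSum-suc : (n : ℕ) → snakeSum (suc n) ≡ downSum n
  snakeSum-suc n = trans (∑B-suc (weight isSnake) n) (∑B-cong n λ ρ ρ∈ → begin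
    ins± 1 (weight isSnake) (shift ρ)
      ≡⟨ ins±1-head (weight isSnake)
           (λ y≥2 L≥2 R≥2 → weight-cancels isSnake y≥2 L≥2 (upFrom-toggle±1 (+ 0) _ _ _ y≥2 L≥2 R≥2))
           (All-AtLeast2-shift ρ∈) ⟩
    weight isSnake (+ 1 ∷ shift ρ) + + 0
      ≡⟨ ℤP.+-identityʳ _ ⟩
    𝟙 (downFrom (+ 1) (shift ρ)) * c (invD (+ 1 ∷ shift ρ)) * sign (even (neg (shift ρ)))
      ≡⟨ cong₂ _*_ (cong₂ _*_ (cong 𝟙 (downFrom-1-shift ρ∈))
                              (trans (cong c (invD-±1∷shift ρ∈ (+ 1) (count<1-shift ρ∈) (count<-1-shift ρ∈)))
                                     (c-parity (neg ρ) (invD ρ))))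
                   (cong (sign ∘ even) (neg-relabel sucᴿ ρ)) ⟩
    weight (downFrom (+ 0)) ρ
      ∎)

  downSum-suc : (n : ℕ) → downSum (suc n) ≡ - snakeSum n
  downSum-suc n = trans (∑B-suc (weight (downFrom (+ 0))) n) (trans (∑B-cong n λ ρ ρ∈ → begin
    ins± 1 (weight (downFrom (+ 0))) (shift ρ)
      ≡⟨ ins±1-head (weight (downFrom (+ 0)))
           (λ y≥2 L≥2 R≥2 → weight-cancels (downFrom (+ 0)) y≥2 L≥2 (downFrom-toggle±1 (+ 0) _ _ _ y≥2 L≥2 R≥2))
           (All-AtLeast2-shift ρ∈) ⟩
    + 0 + weight (downFrom (+ 0)) (-[1+ 0 ] ∷ shift ρ)
      ≡⟨ ℤP.+-identityˡ _ ⟩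
    𝟙 (upFrom -[1+ 0 ] (shift ρ)) * c (invD (-[1+ 0 ] ∷ shift ρ)) * sign (even (suc (neg (shift ρ))))
      ≡⟨ cong₂ _*_ (cong₂ _*_ (cong 𝟙 (upFrom-−1-shift ρ∈))
                              (trans (cong c (invD-±1∷shift ρ∈ -[1+ 0 ] (count<-1-shift ρ∈) (count<1-shift ρ∈)))
                                     (c-parity (neg ρ) (invD ρ))))
                   (trans (cong sign (even-suc (neg (shift ρ))))
                          (trans (sign-not _) (cong (-_ ∘ sign ∘ even) (neg-relabel sucᴿ ρ)))) ⟩
    𝟙 (isSnake ρ) * c (invD ρ) * - sign (inD ρ)
      ≡⟨ sym (ℤP.neg-distribʳ-* (𝟙 (isSnake ρ) * c (invD ρ)) (sign (inD ρ))) ⟩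
    - weight isSnake ρ
      ∎) (∑-neg (weight isSnake) (B n)))

  snakeSum≗ : snakeSum ≗ c 0 ⊠ cos+sin
  downSum≗ : downSum ≗ c 0 ⊠ cos-sin
  snakeSum≗ zero    = solve 1 (λ c₀ → con (+ 1) :* c₀ :* con (+ 1) :+ con (+ 0) := c₀ :* con (+ 1)) refl (c 0)
  snakeSum≗ (suc n) = trans (snakeSum-suc n) (trans (downSum≗ n) (cong (c 0 *_) (sym (∂[cos+sin] n))))
  downSum≗ zero    = solve 1 (λ c₀ → con (+ 1) :* c₀ :* con (+ 1) :+ con (+ 0) := c₀ :* con (+ 1)) refl (c 0)
  downSum≗ (suc n) = trans (downSum-suc n)
    (trans (cong -_ (snakeSum≗ n)) (trans (ℤP.neg-distribʳ-* (c 0) _) (cong (c 0 *_) (sym (∂[cos-sin] n)))))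

mutual
  upFrom-replace₂ : {y y′ : ℤ} (t : ℤ) (A B : List ℤ) → Alike (lastOr t A) x x′ →
                    (x <ᵇ y) ≡ (x′ <ᵇ y′) → (y <ᵇ x) ≡ (y′ <ᵇ x′) → AlikeHead B y y′ →
                    upFrom t (A ++ x ∷ y ∷ B) ≡ upFrom t (A ++ x′ ∷ y′ ∷ B)
  upFrom-replace₂ t []      B (t<x , _) x<y y<x next = cong₂ _∧_ t<x (cong₂ _∧_ y<x (upFrom-replaceHead B next))
  upFrom-replace₂ t (a ∷ A) B alike      x<y y<x next = cong ((t <ᵇ a) ∧_) (downFrom-replace₂ a A B alike x<y y<x next)

  downFrom-replace₂ : {y y′ : ℤ} (t : ℤ) (A B : List ℤ) → Alike (lastOr t A) x x′ →
                      (x <ᵇ y) ≡ (x′ <ᵇ y′) → (y <ᵇ x) ≡ (y′ <ᵇ x′) → AlikeHead B y y′ →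
                      downFrom t (A ++ x ∷ y ∷ B) ≡ downFrom t (A ++ x′ ∷ y′ ∷ B)
  downFrom-replace₂ t []      B (_ , x<t) x<y y<x next = cong₂ _∧_ x<t (cong₂ _∧_ x<y (downFrom-replaceHead B next))
  downFrom-replace₂ t (a ∷ A) B alike      x<y y<x next = cong ((a <ᵇ t) ∧_) (upFrom-replace₂ a A B alike x<y y<x next)

data OneOrTwo : ℤ → Set where
  one⁺ : OneOrTwo (+ 1)
  one⁻ : OneOrTwo -[1+ 0 ]
  two⁺ : OneOrTwo (+ 2)
  two⁻ : OneOrTwo -[1+ 1 ]

data AtLeast3 : ℤ → Set where
  +≥3 : ∀ k → AtLeast3 (+ suc (suc (suc k)))
  -≥3 : ∀ k → AtLeast3 -[1+ suc (suc k) ]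

OneOrTwo-neg : OneOrTwo x → OneOrTwo (- x)
OneOrTwo-neg one⁺ = one⁻
OneOrTwo-neg one⁻ = one⁺
OneOrTwo-neg two⁺ = two⁻
OneOrTwo-neg two⁻ = two⁺

AtLeast3-neg : {u : ℤ} → AtLeast3 u → AtLeast3 (- u)
AtLeast3-neg (+≥3 k) = -≥3 k
AtLeast3-neg (-≥3 k) = +≥3 k

AtLeast3-alike0 : {u : ℤ} → AtLeast3 u → OneOrTwo x → Alike u x (+ 0)
AtLeast3-alike0 (+≥3 k) one⁺ = refl , refl
AtLeast3-alike0 (+≥3 k) one⁻ = refl , refl
AtLeast3-alike0 (+≥3 k) two⁺ = refl , refl
AtLeast3-alike0 (+≥3 k) two⁻ = refl , refl
AtLeast3-alike0 (-≥3 k) one⁺ = refl , refl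
AtLeast3-alike0 (-≥3 k) one⁻ = refl , refl
AtLeast3-alike0 (-≥3 k) two⁺ = refl , refl
AtLeast3-alike0 (-≥3 k) two⁻ = refl , refl

AtLeast3-alike : {u : ℤ} → AtLeast3 u → OneOrTwo x → OneOrTwo x′ → Alike u x x′
AtLeast3-alike u≥3 x∈ x′∈ =
  let u<x , x<u = AtLeast3-alike0 u≥3 x∈ ; u<x′ , x′<u = AtLeast3-alike0 u≥3 x′∈ in
  trans u<x (sym u<x′) , trans x<u (sym x′<u)

All-AtLeast3-shift² : {n : ℕ} {ρ : List ℤ} → All (Entry n) ρ → All AtLeast3 (shift (shift ρ))
All-AtLeast3-shift² []                  = []
All-AtLeast3-shift² (entry⁺ {k} _ ∷ ρ∈) = +≥3 k ∷ All-AtLeast3-shift² ρ∈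
All-AtLeast3-shift² (entry⁻ {k} _ ∷ ρ∈) = -≥3 k ∷ All-AtLeast3-shift² ρ∈

count-replace₂ : (p : A → Bool) {x x′ y y′ : A} (As Bs Cs : List A) → p x ≡ p x′ → p y ≡ p y′ →
                 count p (As ++ x ∷ Bs ++ y ∷ Cs) ≡ count p (As ++ x′ ∷ Bs ++ y′ ∷ Cs)
count-replace₂ p {x′ = x′} {y} {y′} As Bs Cs px≡px′ py≡py′ = begin
  count p (As ++ _ ∷ Bs ++ y ∷ Cs)      ≡⟨ count-replace p As (Bs ++ y ∷ Cs) px≡px′ ⟩
  count p (As ++ x′ ∷ Bs ++ y ∷ Cs)     ≡⟨ cong (count p) (sym (++-assoc As (x′ ∷ Bs) (y ∷ Cs))) ⟩
  count p ((As ++ x′ ∷ Bs) ++ y ∷ Cs)   ≡⟨ count-replace p (As ++ x′ ∷ Bs) Cs py≡py′ ⟩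
  count p ((As ++ x′ ∷ Bs) ++ y′ ∷ Cs)  ≡⟨ cong (count p) (++-assoc As (x′ ∷ Bs) (y′ ∷ Cs)) ⟩
  count p (As ++ x′ ∷ Bs ++ y′ ∷ Cs)    ∎

count<small : {S : List ℤ} → All AtLeast3 S → OneOrTwo x → count (_<ᵇ x) S ≡ count (_<ᵇ + 0) S
count<small S≥3 x∈ = count-cong-All (λ u≥3 → proj₁ (AtLeast3-alike0 u≥3 x∈)) S≥3

invD-small₁ : {y : ℤ} (Q S : List ℤ) → All AtLeast3 Q → All AtLeast3 S → OneOrTwo y →
              invD (Q ++ y ∷ S) ≡ invD (Q ++ + 0 ∷ S)
invD-small₁ []      S _            S≥3 y∈ =
  cong (ℕ._+ invD S) (cong₂ ℕ._+_ (count<small S≥3 y∈) (count<small S≥3 (OneOrTwo-neg y∈)))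
invD-small₁ (q ∷ Q) S (q≥3 ∷ Q≥3) S≥3 y∈ = cong₂ ℕ._+_
  (cong₂ ℕ._+_ (count-replace (_<ᵇ q) Q S (proj₂ (AtLeast3-alike0 q≥3 y∈)))
               (count-replace (_<ᵇ - q) Q S (proj₂ (AtLeast3-alike0 (AtLeast3-neg q≥3) y∈))))
  (invD-small₁ Q S Q≥3 S≥3 y∈)

-- Entries of absolute value at least 3 compare with ±1, ±2 as with 0, so only the inversions
-- within the pair x, y change.
invD-small₂ : {y : ℤ} (P Q S : List ℤ) → All AtLeast3 P → All AtLeast3 Q → All AtLeast3 S → OneOrTwo x → OneOrTwo y →
              invD (P ++ x ∷ Q ++ y ∷ S) ≡ invD (P ++ + 0 ∷ Q ++ + 0 ∷ S) ℕ.+ invD (x ∷ y ∷ [])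
invD-small₂ {x} {y} [] Q S _ Q≥3 S≥3 x∈ y∈ = begin
  row x (Q ++ y ∷ S) ℕ.+ invD (Q ++ y ∷ S)
    ≡⟨ cong₂ ℕ._+_ (cong₂ ℕ._+_ (counts x x∈) (counts (- x) (OneOrTwo-neg x∈))) (invD-small₁ Q S Q≥3 S≥3 y∈) ⟩
  (a ℕ.+ (p ℕ.+ b)) ℕ.+ (a ℕ.+ (q ℕ.+ b)) ℕ.+ I
    ≡⟨ cong (ℕ._+ I) (trans (cong₂ ℕ._+_ (ℕ+.x∙yz≈xz∙y a p b) (ℕ+.x∙yz≈xz∙y a q b))
                            (ℕ+.interchange (a ℕ.+ b) p (a ℕ.+ b) q)) ⟩
  (a ℕ.+ b) ℕ.+ (a ℕ.+ b) ℕ.+ (p ℕ.+ q) ℕ.+ I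
    ≡⟨ ℕ+.xy∙z≈xz∙y ((a ℕ.+ b) ℕ.+ (a ℕ.+ b)) (p ℕ.+ q) I ⟩
  (a ℕ.+ b) ℕ.+ (a ℕ.+ b) ℕ.+ I ℕ.+ (p ℕ.+ q)
    ≡⟨ cong₂ (λ u v → u ℕ.+ u ℕ.+ I ℕ.+ v) (sym (count-++ (_<ᵇ + 0) Q (+ 0 ∷ S))) (sym (ℕP.+-identityʳ (p ℕ.+ q))) ⟩
  invD (+ 0 ∷ Q ++ + 0 ∷ S) ℕ.+ invD (x ∷ y ∷ [])
    ∎
  where
  row : ℤ → List ℤ → ℕ
  row z L = count (_<ᵇ z) L ℕ.+ count (_<ᵇ - z) L
  a = count (_<ᵇ + 0) Q
  b = count (_<ᵇ + 0) S
  p = count (_<ᵇ x) (y ∷ [])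
  q = count (_<ᵇ - x) (y ∷ [])
  I = invD (Q ++ + 0 ∷ S)
  counts : (z : ℤ) → OneOrTwo z → count (_<ᵇ z) (Q ++ y ∷ S) ≡ a ℕ.+ (count (_<ᵇ z) (y ∷ []) ℕ.+ b)
  counts z z∈ = trans (count-++ (_<ᵇ z) Q (y ∷ S))
    (cong₂ ℕ._+_ (count<small Q≥3 z∈) (trans (count-++ (_<ᵇ z) (y ∷ []) S) (cong (_ ℕ.+_) (count<small S≥3 z∈))))
invD-small₂ {x} {y} (r ∷ P) Q S (r≥3 ∷ P≥3) Q≥3 S≥3 x∈ y∈ = trans (cong₂ ℕ._+_
    (cong₂ ℕ._+_ (count-replace₂ (_<ᵇ r) P Q S (proj₂ (AtLeast3-alike0 r≥3 x∈)) (proj₂ (AtLeast3-alike0 r≥3 y∈)))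
                 (count-replace₂ (_<ᵇ - r) P Q S (proj₂ (AtLeast3-alike0 (AtLeast3-neg r≥3) x∈))
                                                 (proj₂ (AtLeast3-alike0 (AtLeast3-neg r≥3) y∈))))
    (invD-small₂ P Q S P≥3 Q≥3 S≥3 x∈ y∈))
  (sym (ℕP.+-assoc (count (_<ᵇ r) (P ++ + 0 ∷ Q ++ + 0 ∷ S) ℕ.+ count (_<ᵇ - r) (P ++ + 0 ∷ Q ++ + 0 ∷ S))
                   (invD (P ++ + 0 ∷ Q ++ + 0 ∷ S)) (invD (x ∷ y ∷ []))))

module _ {y x″ y″ : ℤ} {P Q S : List ℤ} (P≥3 : All AtLeast3 P) (Q≥3 : All AtLeast3 Q) (S≥3 : All AtLeast3 S)
         (x∈ : OneOrTwo x) (y∈ : OneOrTwo y) (x″∈ : OneOrTwo x″) (y″∈ : OneOrTwo y″) where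

  invD-parity-flip : even (invD (x″ ∷ y″ ∷ [])) ≡ not (even (invD (x ∷ y ∷ []))) →
                     even (invD (P ++ x″ ∷ Q ++ y″ ∷ S)) ≡ not (even (invD (P ++ x ∷ Q ++ y ∷ S)))
  invD-parity-flip flip = begin
    even (invD (P ++ x″ ∷ Q ++ y″ ∷ S))          ≡⟨ cong even (invD-small₂ P Q S P≥3 Q≥3 S≥3 x″∈ y″∈) ⟩
    even (I ℕ.+ invD (x″ ∷ y″ ∷ []))              ≡⟨ even-+-flip I flip ⟩
    not (even (I ℕ.+ invD (x ∷ y ∷ [])))          ≡⟨ cong (not ∘ even) (sym (invD-small₂ P Q S P≥3 Q≥3 S≥3 x∈ y∈)) ⟩
    not (even (invD (P ++ x ∷ Q ++ y ∷ S)))       ∎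
    where I = invD (P ++ + 0 ∷ Q ++ + 0 ∷ S)

isSnake-replace-apart : {y x″ y″ q : ℤ} (P Q S : List ℤ) → All AtLeast3 P → AtLeast3 q → All AtLeast3 Q → All AtLeast3 S →
                        OneOrTwo x → OneOrTwo y → OneOrTwo x″ → OneOrTwo y″ → Alike (+ 0) x x″ →
                        isSnake (P ++ x ∷ q ∷ Q ++ y ∷ S) ≡ isSnake (P ++ x″ ∷ q ∷ Q ++ y″ ∷ S)
isSnake-replace-apart {x} {y} {x″} {y″} {q} P Q S P≥3 q≥3 Q≥3 S≥3 x∈ y∈ x″∈ y″∈ alike0 = begin
  upFrom (+ 0) (P ++ x ∷ q ∷ Q ++ y ∷ S)
    ≡⟨ upFrom-replace (+ 0) P (q ∷ Q ++ y ∷ S) (alike-last P P≥3 alike0) (AtLeast3-alike q≥3 x∈ x″∈) ⟩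
  upFrom (+ 0) (P ++ x″ ∷ q ∷ Q ++ y ∷ S)
    ≡⟨ cong (upFrom (+ 0)) (sym (++-assoc P (x″ ∷ q ∷ Q) (y ∷ S))) ⟩
  upFrom (+ 0) ((P ++ x″ ∷ q ∷ Q) ++ y ∷ S)
    ≡⟨ upFrom-replace (+ 0) (P ++ x″ ∷ q ∷ Q) S
         (subst (λ u → Alike u y y″) (sym (lastOr-++ (+ 0) x″ P (q ∷ Q))) (AtLeast3-alike (All-lastOr q≥3 Q≥3) y∈ y″∈))
         (All-AlikeHead (λ u≥3 → AtLeast3-alike u≥3 y∈ y″∈) S≥3) ⟩
  upFrom (+ 0) ((P ++ x″ ∷ q ∷ Q) ++ y″ ∷ S)
    ≡⟨ cong (upFrom (+ 0)) (++-assoc P (x″ ∷ q ∷ Q) (y″ ∷ S)) ⟩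
  upFrom (+ 0) (P ++ x″ ∷ q ∷ Q ++ y″ ∷ S)
    ∎
  where
  alike-last : ∀ {t} A → All AtLeast3 A → Alike t x x″ → Alike (lastOr t A) x x″
  alike-last []      _            alike = alike
  alike-last (a ∷ A) (a≥3 ∷ A≥3) _     = alike-last A A≥3 (AtLeast3-alike a≥3 x∈ x″∈)

isSnake-replace-adjacent : {y x″ y″ : ℤ} (P S : List ℤ) → All AtLeast3 S → OneOrTwo y → OneOrTwo y″ →
                           Alike (lastOr (+ 0) P) x x″ → (x <ᵇ y) ≡ (x″ <ᵇ y″) → (y <ᵇ x) ≡ (y″ <ᵇ x″) →
                           isSnake (P ++ x ∷ y ∷ S) ≡ isSnake (P ++ x″ ∷ y″ ∷ S)
isSnake-replace-adjacent P S S≥3 y∈ y″∈ alike x<y y<x =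
  upFrom-replace₂ (+ 0) P S alike x<y y<x (All-AlikeHead (λ u≥3 → AtLeast3-alike u≥3 y∈ y″∈) S≥3)

invSign : List ℤ → ℤ
invSign π = 𝟙 (isSnake π) * sign (even (invD π))

invSign-cancel : (π π″ : List ℤ) → isSnake π ≡ isSnake π″ → even (invD π″) ≡ not (even (invD π)) →
                 invSign π + invSign π″ ≡ + 0
invSign-cancel π π″ same flip =
  trans (cong (_+_ (invSign π)) (cong₂ _*_ (cong 𝟙 (sym same)) (cong sign flip)))
        (s*sign+s*sign-not (𝟙 (isSnake π)) (even (invD π)))

bothOrders : ℤ → ℤ → List ℤ → List ℤ → List ℤ → ℤ
bothOrders a b P Q S = invSign (P ++ a ∷ Q ++ b ∷ S) + invSign (P ++ b ∷ Q ++ a ∷ S)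

placements : List ℤ → List ℤ → List ℤ → ℤ
placements P Q S = (bothOrders (+ 1) (+ 2) P Q S + bothOrders -[1+ 0 ] (+ 2) P Q S)
                 + (bothOrders (+ 1) -[1+ 1 ] P Q S + bothOrders -[1+ 0 ] -[1+ 1 ] P Q S)

0+0+0+0 : {a b c d : ℤ} → a ≡ + 0 → b ≡ + 0 → c ≡ + 0 → d ≡ + 0 → a + (b + (c + d)) ≡ + 0
0+0+0+0 refl refl refl refl = refl

-- Swapping the absolute values of the two small entries keeps every sign, hence the snake shape,
-- and changes the parity of the inversions between them.
placements-apart : (P : List ℤ) (q : ℤ) (Q S : List ℤ) → All AtLeast3 P → AtLeast3 q → All AtLeast3 Q → All AtLeast3 S →
                   placements P (q ∷ Q) S ≡ + 0
placements-apart P q Q S P≥3 q≥3 Q≥3 S≥3 = trans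
  (solve 8 (λ a₁ a₂ b₁ b₂ c₁ c₂ d₁ d₂ → ((a₁ :+ a₂) :+ (b₁ :+ b₂)) :+ ((c₁ :+ c₂) :+ (d₁ :+ d₂))
                                       := (a₁ :+ a₂) :+ ((c₁ :+ b₂) :+ ((b₁ :+ c₂) :+ (d₁ :+ d₂)))) refl
     (w (+ 1) (+ 2)) (w (+ 2) (+ 1)) (w -[1+ 0 ] (+ 2)) (w (+ 2) -[1+ 0 ])
     (w (+ 1) -[1+ 1 ]) (w -[1+ 1 ] (+ 1)) (w -[1+ 0 ] -[1+ 1 ]) (w -[1+ 1 ] -[1+ 0 ]))
  (0+0+0+0 (swap one⁺ two⁺ two⁺ one⁺ (refl , refl) refl) (swap one⁺ two⁻ two⁺ one⁻ (refl , refl) refl)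
           (swap one⁻ two⁺ two⁻ one⁺ (refl , refl) refl) (swap one⁻ two⁻ two⁻ one⁻ (refl , refl) refl))
  where
  w : ℤ → ℤ → ℤ
  w x y = invSign (P ++ x ∷ (q ∷ Q) ++ y ∷ S)
  swap : ∀ {x y x″ y″} → OneOrTwo x → OneOrTwo y → OneOrTwo x″ → OneOrTwo y″ → Alike (+ 0) x x″ →
         even (invD (x″ ∷ y″ ∷ [])) ≡ not (even (invD (x ∷ y ∷ []))) → w x y + w x″ y″ ≡ + 0
  swap {x} {y} {x″} {y″} x∈ y∈ x″∈ y″∈ alike0 flip =
    invSign-cancel (P ++ x ∷ (q ∷ Q) ++ y ∷ S) (P ++ x″ ∷ (q ∷ Q) ++ y″ ∷ S)
    (isSnake-replace-apart P Q S P≥3 q≥3 Q≥3 S≥3 x∈ y∈ x″∈ y″∈ alike0)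
    (invD-parity-flip P≥3 (q≥3 ∷ Q≥3) S≥3 x∈ y∈ x″∈ y″∈ flip)

-- Adjacent small entries x y are traded for x″ y″ with the same relative order and signs
-- (e.g. 1 2 ↔ -2 -1), which changes the parity of their inversions.
placements-adjacent : (p : ℤ) (P S : List ℤ) → AtLeast3 p → All AtLeast3 P → All AtLeast3 S →
                      placements (p ∷ P) [] S ≡ + 0
placements-adjacent p P S p≥3 P≥3 S≥3 = trans
  (solve 8 (λ a₁ a₂ b₁ b₂ c₁ c₂ d₁ d₂ → ((a₁ :+ a₂) :+ (b₁ :+ b₂)) :+ ((c₁ :+ c₂) :+ (d₁ :+ d₂))
                                       := (a₁ :+ d₂) :+ ((a₂ :+ d₁) :+ ((c₁ :+ b₂) :+ (b₁ :+ c₂)))) refl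
     (w (+ 1) (+ 2)) (w (+ 2) (+ 1)) (w -[1+ 0 ] (+ 2)) (w (+ 2) -[1+ 0 ])
     (w (+ 1) -[1+ 1 ]) (w -[1+ 1 ] (+ 1)) (w -[1+ 0 ] -[1+ 1 ]) (w -[1+ 1 ] -[1+ 0 ]))
  (0+0+0+0 (trade one⁺ two⁺ two⁻ one⁻ refl refl refl) (trade two⁺ one⁺ one⁻ two⁻ refl refl refl)
           (trade one⁺ two⁻ two⁺ one⁻ refl refl refl) (trade one⁻ two⁺ two⁻ one⁺ refl refl refl))
  where
  w : ℤ → ℤ → ℤ
  w x y = invSign (p ∷ P ++ x ∷ y ∷ S)
  trade : ∀ {x y x″ y″} → OneOrTwo x → OneOrTwo y → OneOrTwo x″ → OneOrTwo y″ →
          (x <ᵇ y) ≡ (x″ <ᵇ y″) → (y <ᵇ x) ≡ (y″ <ᵇ x″) →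
          even (invD (x″ ∷ y″ ∷ [])) ≡ not (even (invD (x ∷ y ∷ []))) → w x y + w x″ y″ ≡ + 0
  trade {x} {y} {x″} {y″} x∈ y∈ x″∈ y″∈ x<y y<x flip =
    invSign-cancel (p ∷ P ++ x ∷ y ∷ S) (p ∷ P ++ x″ ∷ y″ ∷ S)
    (isSnake-replace-adjacent (p ∷ P) S S≥3 y∈ y″∈ (AtLeast3-alike (All-lastOr p≥3 P≥3) x∈ x″∈) x<y y<x)
    (invD-parity-flip (p≥3 ∷ P≥3) [] S≥3 x∈ y∈ x″∈ y″∈ flip)

-- Of the eight placements in front only 2 1 S, 1 -2 S and 2 -1 S can be snakes, and the last two cancel.
placements-front : (S : List ℤ) → All AtLeast3 S → placements [] [] S ≡ invSign (+ 2 ∷ + 1 ∷ S)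
placements-front S S≥3 = begin
  placements [] [] S
    ≡⟨ solve 8 (λ a₁ a₂ b₁ b₂ c₁ c₂ d₁ d₂ → ((a₁ :+ a₂) :+ (b₁ :+ b₂)) :+ ((c₁ :+ c₂) :+ (d₁ :+ d₂))
                                         := a₂ :+ (c₁ :+ b₂) :+ (a₁ :+ b₁ :+ c₂ :+ d₁ :+ d₂)) refl
         (w (+ 1) (+ 2)) (w (+ 2) (+ 1)) (w -[1+ 0 ] (+ 2)) (w (+ 2) -[1+ 0 ])
         (w (+ 1) -[1+ 1 ]) (w -[1+ 1 ] (+ 1)) (w -[1+ 0 ] -[1+ 1 ]) (w -[1+ 1 ] -[1+ 0 ]) ⟩
  w (+ 2) (+ 1) + (w (+ 1) -[1+ 1 ] + w (+ 2) -[1+ 0 ]) + (+ 0 + + 0 + + 0 + + 0 + + 0)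
    ≡⟨ cong (λ z → w (+ 2) (+ 1) + z + + 0) trade ⟩
  w (+ 2) (+ 1) + + 0 + + 0
    ≡⟨ trans (ℤP.+-identityʳ _) (ℤP.+-identityʳ _) ⟩
  invSign (+ 2 ∷ + 1 ∷ S)
    ∎
  where
  w : ℤ → ℤ → ℤ
  w x y = invSign (x ∷ y ∷ S)
  trade : w (+ 1) -[1+ 1 ] + w (+ 2) -[1+ 0 ] ≡ + 0
  trade = invSign-cancel (+ 1 ∷ -[1+ 1 ] ∷ S) (+ 2 ∷ -[1+ 0 ] ∷ S)
    (isSnake-replace-adjacent {+ 1} { -[1+ 1 ] } {+ 2} { -[1+ 0 ] } [] S S≥3 two⁻ one⁻ (refl , refl) refl refl)
    (invD-parity-flip [] [] S≥3 one⁺ two⁻ two⁺ one⁻ refl)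

∑₃-placements : {σ : List ℤ} → All AtLeast3 σ → ∑₃ placements σ ≡ placements [] [] σ
∑₃-placements σ≥3 = ∑₃-front σ≥3
  (λ y≥3 Q≥3 S≥3 → placements-apart [] _ _ _ [] y≥3 Q≥3 S≥3)
  (λ { {Q = []}    y≥3 X≥3 _            S≥3 → placements-adjacent _ _ _ y≥3 X≥3 S≥3
     ; {Q = q ∷ Q} y≥3 X≥3 (q≥3 ∷ Q≥3) S≥3 → placements-apart (_ ∷ _) q Q _ (y≥3 ∷ X≥3) q≥3 Q≥3 S≥3 })

invSignedSnakes : Seq
invSignedSnakes = ∑B invSign

invSign-front : {n : ℕ} {ρ : List ℤ} → All (Entry n) ρ → invSign (+ 2 ∷ + 1 ∷ shift (shift ρ)) ≡ - invSign ρ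
invSign-front {ρ = ρ} ρ∈ = begin
  𝟙 (upFrom (+ 1) σ) * sign (even (invD (+ 2 ∷ + 1 ∷ σ)))
    ≡⟨ cong₂ (λ b e → 𝟙 b * sign e) (upFrom-1-shift² ρ∈) parity ⟩
  𝟙 (isSnake ρ) * sign (not (even (invD ρ)))
    ≡⟨ cong (𝟙 (isSnake ρ) *_) (sign-not (even (invD ρ))) ⟩
  𝟙 (isSnake ρ) * - sign (even (invD ρ))
    ≡⟨ sym (ℤP.neg-distribʳ-* (𝟙 (isSnake ρ)) _) ⟩
  - invSign ρ
    ∎
  where
  σ = shift (shift ρ)
  c = count (_<ᵇ + 0) σ
  upFrom-1-shift² : ∀ {ρ} → All (Entry _) ρ → upFrom (+ 1) (shift (shift ρ)) ≡ upFrom (+ 0) ρ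
  upFrom-1-shift² []                         = refl
  upFrom-1-shift² {r ∷ ρ} (entry⁺ _ ∷ _) = trans (downFrom-relabel sucᴿ (act suc r) (shift ρ)) (downFrom-relabel sucᴿ r ρ)
  upFrom-1-shift² {r ∷ ρ} (entry⁻ _ ∷ _) = refl
  parity : even (invD (+ 2 ∷ + 1 ∷ σ)) ≡ not (even (invD ρ))
  parity = begin
    even (invD (+ 2 ∷ + 1 ∷ σ))
      ≡⟨ cong even (invD-small₂ [] [] σ [] [] (All-AtLeast3-shift² ρ∈) two⁺ one⁺) ⟩
    even (c ℕ.+ c ℕ.+ (c ℕ.+ c ℕ.+ invD σ) ℕ.+ 1)
      ≡⟨ trans (cong even (ℕP.+-comm (c ℕ.+ c ℕ.+ (c ℕ.+ c ℕ.+ invD σ)) 1))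
               (even-suc (c ℕ.+ c ℕ.+ (c ℕ.+ c ℕ.+ invD σ))) ⟩
    not (even (c ℕ.+ c ℕ.+ (c ℕ.+ c ℕ.+ invD σ)))
      ≡⟨ cong not (trans (even-double c _) (even-double c (invD σ))) ⟩
    not (even (invD σ))
      ≡⟨ cong (not ∘ even) (trans (invD-relabel sucᴿ (shift ρ)) (invD-relabel sucᴿ ρ)) ⟩
    not (even (invD ρ))
      ∎

invSignedSnakes-suc-suc : (n : ℕ) → invSignedSnakes (suc (suc n)) ≡ - invSignedSnakes n
invSignedSnakes-suc-suc n = begin
  invSignedSnakes (suc (suc n))
    ≡⟨ trans (∑B-suc invSign (suc n)) (∑B-suc (λ ρ → ins± 1 invSign (shift ρ)) n) ⟩
  ∑B (λ ρ → ins± 1 (λ τ → ins± 1 invSign (shift τ)) (shift ρ)) n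
    ≡⟨ ∑B-cong n two-smallest ⟩
  ∑B (λ ρ → - invSign ρ) n
    ≡⟨ ∑-neg invSign (B n) ⟩
  - invSignedSnakes n
    ∎
  where
  inserting : (σ : List ℤ) (b : ℤ) →
              ∑ (ins± 1 invSign) (insertions b σ) ≡ ∑₃ (bothOrders (+ 1) b) σ + ∑₃ (bothOrders -[1+ 0 ] b) σ
  inserting σ b =
    trans (∑-+ (λ τ → ∑ invSign (insertions (+ 1) τ)) (λ τ → ∑ invSign (insertions -[1+ 0 ] τ)) (insertions b σ))
          (cong₂ _+_ (∑-insertions² invSign (+ 1) b σ) (∑-insertions² invSign -[1+ 0 ] b σ))
  two-smallest : ∀ ρ → All (Entry n) ρ → ins± 1 (λ τ → ins± 1 invSign (shift τ)) (shift ρ) ≡ - invSign ρ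
  two-smallest ρ ρ∈ = begin
    ins± 1 (λ τ → ins± 1 invSign (shift τ)) (shift ρ)
      ≡⟨ sym (cong₂ _+_ (∑-insertions-map (ins± 1 invSign) (act suc) (+ 1) (shift ρ))
                        (∑-insertions-map (ins± 1 invSign) (act suc) -[1+ 0 ] (shift ρ))) ⟩
    ∑ (ins± 1 invSign) (insertions (+ 2) σ) + ∑ (ins± 1 invSign) (insertions -[1+ 1 ] σ)
      ≡⟨ cong₂ _+_ (inserting σ (+ 2)) (inserting σ -[1+ 1 ]) ⟩
    (∑₃ (bothOrders (+ 1) (+ 2)) σ + ∑₃ (bothOrders -[1+ 0 ] (+ 2)) σ)
      + (∑₃ (bothOrders (+ 1) -[1+ 1 ]) σ + ∑₃ (bothOrders -[1+ 0 ] -[1+ 1 ]) σ)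
      ≡⟨ sym (trans (∑₃-+ _ _ σ) (cong₂ _+_ (∑₃-+ _ _ σ) (∑₃-+ _ _ σ))) ⟩
    ∑₃ placements σ
      ≡⟨ ∑₃-placements (All-AtLeast3-shift² ρ∈) ⟩
    placements [] [] σ
      ≡⟨ placements-front σ (All-AtLeast3-shift² ρ∈) ⟩
    invSign (+ 2 ∷ + 1 ∷ σ)
      ≡⟨ invSign-front ρ∈ ⟩
    - invSign ρ
      ∎
    where σ = shift (shift ρ)

invSignedSnakes≗cos+sin : invSignedSnakes ≗ cos+sin
invSignedSnakes≗cos+sin zero          = refl
invSignedSnakes≗cos+sin (suc zero)    = refl
invSignedSnakes≗cos+sin (suc (suc n)) = begin
  invSignedSnakes (suc (suc n))     ≡⟨ invSignedSnakes-suc-suc n ⟩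
  - invSignedSnakes n               ≡⟨ cong -_ (invSignedSnakes≗cos+sin n) ⟩
  - cos+sin n                 ≡⟨ sym (trans (∂[cos+sin] (suc n)) (∂[cos-sin] n)) ⟩
  cos+sin (suc (suc n))       ∎

negSignedSnakes≗cos+sin : ∑B (λ π → 𝟙 (isSnake π) * sign (inD π)) ≗ cos+sin
negSignedSnakes≗cos+sin n = begin
  ∑B (λ π → 𝟙 (isSnake π) * sign (inD π)) n
    ≡⟨ ∑-cong (λ π → cong (_* sign (inD π)) (sym (ℤP.*-identityʳ (𝟙 (isSnake π))))) (B n) ⟩
  snakeSum n
    ≡⟨ snakeSum≗ n ⟩
  + 1 * cos+sin n
    ≡⟨ ℤP.*-identityˡ (cos+sin n) ⟩
  cos+sin n
    ∎
  where open SignedByNegatives (λ _ → + 1) (λ _ _ → refl)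

doublySignedSnakes≗cos+sin : ∑B (λ π → 𝟙 (isSnake π) * sign (even (invD π)) * sign (inD π)) ≗ cos+sin
doublySignedSnakes≗cos+sin n = trans (snakeSum≗ n) (ℤP.*-identityˡ (cos+sin n))
  where open SignedByNegatives (λ m → sign (even m)) (λ a m → cong sign (even-double a m))

-- snakeClass ε₁ ε₂ unfolds to the four predicates of Defs, since b == true is b and b == false is not b.
infix 7 _==_
_==_ : Bool → Bool → Bool
b == true  = b
b == false = not b

snakeClass : Bool → Bool → List ℤ → Bool
snakeClass ε₁ ε₂ π = isSnake π ∧ inD π == ε₁ ∧ even (invD π) == ε₂

2*𝟙[b==ε] : (b ε : Bool) → + 2 * 𝟙 (b == ε) ≡ + 1 + sign ε * sign b
2*𝟙[b==ε] true  true  = refl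
2*𝟙[b==ε] false true  = refl
2*𝟙[b==ε] true  false = refl
2*𝟙[b==ε] false false = refl

4*𝟙[snakeClass] : (ε₁ ε₂ : Bool) (π : List ℤ) → + 4 * 𝟙 (snakeClass ε₁ ε₂ π) ≡
                  𝟙 (isSnake π) + sign ε₁ * (𝟙 (isSnake π) * sign (inD π))
                  + sign ε₂ * (𝟙 (isSnake π) * sign (even (invD π)))
                  + sign ε₁ * sign ε₂ * (𝟙 (isSnake π) * sign (even (invD π)) * sign (inD π))
4*𝟙[snakeClass] ε₁ ε₂ π = begin
  + 4 * 𝟙 (s ∧ a == ε₁ ∧ b == ε₂)
    ≡⟨ cong (+ 4 *_) (trans (𝟙-∧ s _) (cong (𝟙 s *_) (𝟙-∧ (a == ε₁) (b == ε₂)))) ⟩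
  + 4 * (𝟙 s * (𝟙 (a == ε₁) * 𝟙 (b == ε₂)))
    ≡⟨ solve 3 (λ S P Q → con (+ 4) :* (S :* (P :* Q)) := S :* ((con (+ 2) :* P) :* (con (+ 2) :* Q))) refl
               (𝟙 s) (𝟙 (a == ε₁)) (𝟙 (b == ε₂)) ⟩
  𝟙 s * ((+ 2 * 𝟙 (a == ε₁)) * (+ 2 * 𝟙 (b == ε₂)))
    ≡⟨ cong (𝟙 s *_) (cong₂ _*_ (2*𝟙[b==ε] a ε₁) (2*𝟙[b==ε] b ε₂)) ⟩
  𝟙 s * ((+ 1 + sign ε₁ * sign a) * (+ 1 + sign ε₂ * sign b))
    ≡⟨ solve 5 (λ S e₁ A e₂ B → S :* ((con (+ 1) :+ e₁ :* A) :* (con (+ 1) :+ e₂ :* B))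
                              := S :+ e₁ :* (S :* A) :+ e₂ :* (S :* B) :+ e₁ :* e₂ :* (S :* B :* A)) refl
               (𝟙 s) (sign ε₁) (sign a) (sign ε₂) (sign b) ⟩
  𝟙 s + sign ε₁ * (𝟙 s * sign a) + sign ε₂ * (𝟙 s * sign b) + sign ε₁ * sign ε₂ * (𝟙 s * sign b * sign a)
    ∎
  where
  s = isSnake π
  a = inD π
  b = even (invD π)

4*count-snakeClass : (ε₁ ε₂ : Bool) (n : ℕ) →
                     + 4 * + count (snakeClass ε₁ ε₂) (B n) ≡
                     snakes n + (sign ε₁ + sign ε₂ + sign ε₁ * sign ε₂) * cos+sin n
4*count-snakeClass ε₁ ε₂ n = begin
  + 4 * + count (snakeClass ε₁ ε₂) (B n)
    ≡⟨ cong (+ 4 *_) (count≡∑𝟙 (snakeClass ε₁ ε₂) (B n)) ⟩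
  + 4 * ∑B (λ π → 𝟙 (snakeClass ε₁ ε₂ π)) n
    ≡⟨ sym (∑-*ˡ (+ 4) (λ π → 𝟙 (snakeClass ε₁ ε₂ π)) (B n)) ⟩
  ∑B (λ π → + 4 * 𝟙 (snakeClass ε₁ ε₂ π)) n
    ≡⟨ ∑-cong (4*𝟙[snakeClass] ε₁ ε₂) (B n) ⟩
  ∑B (λ π → f π + e₁ * g π + e₂ * h π + e₁ * e₂ * k π) n
    ≡⟨ trans (∑-+ _ (λ π → e₁ * e₂ * k π) (B n)) (cong₂ _+_
         (trans (∑-+ _ (λ π → e₂ * h π) (B n)) (cong₂ _+_
           (trans (∑-+ f (λ π → e₁ * g π) (B n)) (cong (_+_ (snakes n)) (∑-*ˡ e₁ g (B n))))
           (∑-*ˡ e₂ h (B n))))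
         (∑-*ˡ (e₁ * e₂) k (B n))) ⟩
  snakes n + e₁ * ∑B g n + e₂ * ∑B h n + e₁ * e₂ * ∑B k n
    ≡⟨ cong₂ (λ u v → snakes n + e₁ * u + e₂ * v + e₁ * e₂ * ∑B k n)
             (negSignedSnakes≗cos+sin n) (invSignedSnakes≗cos+sin n) ⟩
  snakes n + e₁ * cos+sin n + e₂ * cos+sin n + e₁ * e₂ * ∑B k n
    ≡⟨ cong (λ u → snakes n + e₁ * cos+sin n + e₂ * cos+sin n + e₁ * e₂ * u) (doublySignedSnakes≗cos+sin n) ⟩
  snakes n + e₁ * cos+sin n + e₂ * cos+sin n + e₁ * e₂ * cos+sin n
    ≡⟨ solve 4 (λ T a b c → T :+ a :* c :+ b :* c :+ a :* b :* c := T :+ (a :+ b :+ a :* b) :* c) refl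
               (snakes n) e₁ e₂ (cos+sin n) ⟩
  snakes n + (e₁ + e₂ + e₁ * e₂) * cos+sin n
    ∎
  where
  e₁ = sign ε₁
  e₂ = sign ε₂
  f g h k : List ℤ → ℤ
  f π = 𝟙 (isSnake π)
  g π = 𝟙 (isSnake π) * sign (inD π)
  h π = 𝟙 (isSnake π) * sign (even (invD π))
  k π = 𝟙 (isSnake π) * sign (even (invD π)) * sign (inD π)

4*SD⁺ : ∀ n → + 4 * + SD⁺ n ≡ snakes n + + 3 * cos+sin n
4*SD⁺ zero    = refl
4*SD⁺ (suc n) = 4*count-snakeClass true true (suc n)

4*SD⁻ : ∀ n → + 4 * + SD⁻ n ≡ snakes n + -[1+ 0 ] * cos+sin n
4*SD⁻ zero    = refl
4*SD⁻ (suc n) = 4*count-snakeClass true false (suc n)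

4*SBD⁺ : ∀ n → + 4 * + SBD⁺ n ≡ snakes n + -[1+ 0 ] * cos+sin n
4*SBD⁺ zero    = refl
4*SBD⁺ (suc n) = 4*count-snakeClass false true (suc n)

4*SBD⁻ : ∀ n → + 4 * + SBD⁻ n ≡ snakes n + -[1+ 0 ] * cos+sin n
4*SBD⁻ zero    = refl
4*SBD⁻ (suc n) = 4*count-snakeClass false false (suc n)

4*[a⋆2[cos-sin]] : (a : Seq) (k : ℤ) → (∀ n → + 4 * a n ≡ snakes n + k * cos+sin n) →
              ∀ n → + 4 * (a ⋆ (+ 2 ⊠ cos-sin)) n ≡
                    + 2 * ((cosD ⋆ cosD) n + (sinD ⋆ sinD) n) + + 2 * k * ((cosD ⋆ cosD) n - (sinD ⋆ sinD) n)
4*[a⋆2[cos-sin]] a k 4a≡ n = begin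
  + 4 * (a ⋆ (+ 2 ⊠ cos-sin)) n
    ≡⟨ sym (⋆-⊠ˡ (+ 4) a (+ 2 ⊠ cos-sin) n) ⟩
  ((+ 4 ⊠ a) ⋆ (+ 2 ⊠ cos-sin)) n
    ≡⟨ trans (⋆-congˡ (+ 2 ⊠ cos-sin) 4a≡ n) (⋆-distribʳ-⊞ snakes (k ⊠ cos+sin) (+ 2 ⊠ cos-sin) n) ⟩
  (snakes ⋆ (+ 2 ⊠ cos-sin)) n + ((k ⊠ cos+sin) ⋆ (+ 2 ⊠ cos-sin)) n
    ≡⟨ cong₂ _+_ (trans (⋆-⊠ʳ (+ 2) snakes cos-sin n) (cong (+ 2 *_) (snakes⋆[cos-sin] n)))
                 (trans (⋆-⊠ˡ k cos+sin (+ 2 ⊠ cos-sin) n)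
                        (cong (k *_) (trans (⋆-⊠ʳ (+ 2) cos+sin cos-sin n) (cong (+ 2 *_) ([cos+sin]⋆[cos-sin] n))))) ⟩
  + 2 * δ n + k * (+ 2 * ((cosD ⋆ cosD) n - (sinD ⋆ sinD) n))
    ≡⟨ cong₂ (λ u v → + 2 * u + v) (sym (cos²+sin² n))
             (solve 3 (λ k c s → k :* (con (+ 2) :* (c :- s)) := con (+ 2) :* k :* (c :- s)) refl
                      k ((cosD ⋆ cosD) n) ((sinD ⋆ sinD) n)) ⟩
  + 2 * ((cosD ⋆ cosD) n + (sinD ⋆ sinD) n) + + 2 * k * ((cosD ⋆ cosD) n - (sinD ⋆ sinD) n)
    ∎

SD⁺⋆2[cos-sin] : (λ n → + SD⁺ n) ⋆ (+ 2 ⊠ cos-sin) ≗ + 2 ⊠ (cosD ⋆ cosD) ⊟ sinD ⋆ sinD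
SD⁺⋆2[cos-sin] n = ℤP.*-cancelˡ-≡ (+ 4) _ _ (trans (4*[a⋆2[cos-sin]] (λ n → + SD⁺ n) (+ 3) 4*SD⁺ n)
  (solve 2 (λ c s → con (+ 2) :* (c :+ s) :+ con (+ 2) :* con (+ 3) :* (c :- s) := con (+ 4) :* (con (+ 2) :* c :- s)) refl
           ((cosD ⋆ cosD) n) ((sinD ⋆ sinD) n)))

⋆2[cos-sin]≗sin² : (a : Seq) → (∀ n → + 4 * a n ≡ snakes n + -[1+ 0 ] * cos+sin n) →
                   a ⋆ (+ 2 ⊠ cos-sin) ≗ sinD ⋆ sinD
⋆2[cos-sin]≗sin² a 4a≡ n = ℤP.*-cancelˡ-≡ (+ 4) _ _ (trans (4*[a⋆2[cos-sin]] a -[1+ 0 ] 4a≡ n)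
  (solve 2 (λ c s → con (+ 2) :* (c :+ s) :+ con (+ 2) :* con -[1+ 0 ] :* (c :- s) := con (+ 4) :* s) refl
           ((cosD ⋆ cosD) n) ((sinD ⋆ sinD) n)))

binomial : ℕ → ℕ → ℕ
binomial i j = (i ℕ.+ j) C i

binomial-zeroʳ : (i : ℕ) → binomial i 0 ≡ 1
binomial-zeroʳ i = trans (cong (_C i) (ℕP.+-identityʳ i)) (nCn≡1 i)

binomial-pascal : (i j : ℕ) → binomial (suc i) (suc j) ≡ binomial i (suc j) ℕ.+ binomial (suc i) j
binomial-pascal i j = sym (trans
  (cong (binomial i (suc j) ℕ.+_) (cong (_C suc i) (sym (ℕP.+-suc i j))))
  (nCk+nC[k+1]≡[n+1]C[k+1] (i ℕ.+ suc j) i))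

binomial-factorials : (i j : ℕ) → binomial i j ℕ.* (i ! ℕ.* j !) ≡ (i ℕ.+ j) !
binomial-factorials i j = begin
  binomial i j ℕ.* (i ! ℕ.* j !)
    ≡⟨ cong (λ m → binomial i j ℕ.* (i ! ℕ.* m !)) (sym (ℕP.m+n∸m≡n i j)) ⟩
  (n C i) ℕ.* (i ! ℕ.* (n ∸ i) !)
    ≡⟨ cong (ℕ._* (i ! ℕ.* (n ∸ i) !)) (nCk≡n!/k![n-k]! i≤n) ⟩
  (n ! ℕ./ (i ! ℕ.* (n ∸ i) !)) {{i !* (n ∸ i) !≢0}} ℕ.* (i ! ℕ.* (n ∸ i) !)
    ≡⟨ m/n*n≡m {{i !* (n ∸ i) !≢0}} (k![n∸k]!∣n! i≤n) ⟩
  n !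
    ∎
  where
  n = i ℕ.+ j
  i≤n = ℕP.m≤m+n i j

antidiagonal : (ℕ → ℕ → ℤ) → ℕ → ℤ
antidiagonal F zero    = F 0 0
antidiagonal F (suc n) = F 0 (suc n) + antidiagonal (λ i → F (suc i)) n

antidiagonal-cong : {F G : ℕ → ℕ → ℤ} → (∀ i j → F i j ≡ G i j) → antidiagonal F ≗ antidiagonal G
antidiagonal-cong F≗G zero    = F≗G 0 0
antidiagonal-cong F≗G (suc n) = cong₂ _+_ (F≗G 0 (suc n)) (antidiagonal-cong (F≗G ∘ suc) n)

antidiagonal-+ : (F G : ℕ → ℕ → ℤ) →
                 antidiagonal (λ i j → F i j + G i j) ≗ antidiagonal F ⊞ antidiagonal G
antidiagonal-+ F G zero    = refl
antidiagonal-+ F G (suc n) =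
  trans (cong (_+_ (F 0 (suc n) + G 0 (suc n))) (antidiagonal-+ (λ i → F (suc i)) (λ i → G (suc i)) n))
        (ℤ+.interchange (F 0 (suc n)) (G 0 (suc n)) _ _)

antidiagonal-last : (F : ℕ → ℕ → ℤ) (n : ℕ) →
                    antidiagonal F (suc n) ≡ antidiagonal (λ i j → F i (suc j)) n + F (suc n) 0
antidiagonal-last F zero    = refl
antidiagonal-last F (suc n) =
  trans (cong (_+_ (F 0 (suc (suc n)))) (antidiagonal-last (λ i → F (suc i)) n))
        (sym (ℤP.+-assoc (F 0 (suc (suc n))) _ _))

∑-upTo≡antidiagonal : (F : ℕ → ℕ → ℤ) (n : ℕ) →
                      ∑ (λ k → F k (n ∸ k)) (upTo (suc n)) ≡ antidiagonal F n
∑-upTo≡antidiagonal F zero    = ℤP.+-identityʳ (F 0 0)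
∑-upTo≡antidiagonal F (suc n) = cong (_+_ (F 0 (suc n))) (begin
  ∑ (λ k → F k (suc n ∸ k)) (applyUpTo suc (suc n))   ≡⟨ cong (∑ (λ k → F k (suc n ∸ k))) (sym (map-upTo suc (suc n))) ⟩
  ∑ (λ k → F k (suc n ∸ k)) (map suc (upTo (suc n)))  ≡⟨ ∑-map (λ k → F k (suc n ∸ k)) suc (upTo (suc n)) ⟩
  ∑ (λ k → F (suc k) (n ∸ k)) (upTo (suc n))          ≡⟨ ∑-upTo≡antidiagonal (λ i → F (suc i)) n ⟩
  antidiagonal (λ i → F (suc i)) n                     ∎)

binomialTerm : Seq → Seq → ℕ → ℕ → ℤ
binomialTerm a b i j = + binomial i j * a i * b j

⋆≡antidiagonal : (a b : Seq) → a ⋆ b ≗ antidiagonal (binomialTerm a b)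
⋆≡antidiagonal a b zero    = sym (cong (_* b 0) (ℤP.*-identityˡ (a 0)))
⋆≡antidiagonal a b (suc n) = sym (begin
  antidiagonal (binomialTerm a b) (suc n)
    ≡⟨ cong (_+_ (binomialTerm a b 0 (suc n))) (trans (antidiagonal-cong pascal n) (antidiagonal-+ H K n)) ⟩
  binomialTerm a b 0 (suc n) + (antidiagonal H n + antidiagonal K n)
    ≡⟨ ℤ+.x∙yz≈y∙xz (binomialTerm a b 0 (suc n)) (antidiagonal H n) (antidiagonal K n) ⟩
  antidiagonal H n + (binomialTerm a b 0 (suc n) + antidiagonal K n)
    ≡⟨ cong (_+_ (antidiagonal H n)) (K-absorbs n) ⟩
  antidiagonal H n + antidiagonal G n
    ≡⟨ sym (cong₂ _+_ (⋆≡antidiagonal (∂ a) b n) (⋆≡antidiagonal a (∂ b) n)) ⟩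
  (∂ a ⋆ b) n + (a ⋆ ∂ b) n
    ∎)
  where
  H G K : ℕ → ℕ → ℤ
  H = binomialTerm (∂ a) b
  G = binomialTerm a (∂ b)
  K i zero    = + 0
  K i (suc j) = G (suc i) j
  pascal : ∀ i j → binomialTerm a b (suc i) j ≡ H i j + K i j
  pascal i zero    = trans (cong (λ c → + c * a (suc i) * b 0) (trans (binomial-zeroʳ (suc i)) (sym (binomial-zeroʳ i))))
                           (sym (ℤP.+-identityʳ _))
  pascal i (suc j) = trans (cong (λ c → + c * a (suc i) * b (suc j)) (binomial-pascal i j))
    (trans (cong (λ c → c * a (suc i) * b (suc j)) (ℤP.pos-+ (binomial i (suc j)) (binomial (suc i) j)))
      (solve 4 (λ x y p q → (x :+ y) :* p :* q := x :* p :* q :+ y :* p :* q) refl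
             (+ binomial i (suc j)) (+ binomial (suc i) j) (a (suc i)) (b (suc j))))
  K-absorbs : ∀ n → binomialTerm a b 0 (suc n) + antidiagonal K n ≡ antidiagonal G n
  K-absorbs zero    = ℤP.+-identityʳ _
  K-absorbs (suc m) = trans (cong (_+_ (binomialTerm a b 0 (suc (suc m)))) (antidiagonal-last K m))
                            (cong (_+_ (G 0 (suc m))) (ℤP.+-identityʳ _))

fromℚᵘ-homo-+ : (x y : ℚᵘ) → ℚ.fromℚᵘ (x ℚᵘ.+ y) ≡ ℚ.fromℚᵘ x ℚ.+ ℚ.fromℚᵘ y
fromℚᵘ-homo-+ x y = ℚP.toℚᵘ-injective (ℚᵘP.≃-trans (ℚP.toℚᵘ-fromℚᵘ (x ℚᵘ.+ y))
  (ℚᵘP.≃-sym (ℚᵘP.≃-trans (ℚP.toℚᵘ-homo-+ (ℚ.fromℚᵘ x) (ℚ.fromℚᵘ y))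
                          (ℚᵘP.+-cong (ℚP.toℚᵘ-fromℚᵘ x) (ℚP.toℚᵘ-fromℚᵘ y)))))

fromℚᵘ-homo-* : (x y : ℚᵘ) → ℚ.fromℚᵘ (x ℚᵘ.* y) ≡ ℚ.fromℚᵘ x ℚ.* ℚ.fromℚᵘ y
fromℚᵘ-homo-* x y = ℚP.toℚᵘ-injective (ℚᵘP.≃-trans (ℚP.toℚᵘ-fromℚᵘ (x ℚᵘ.* y))
  (ℚᵘP.≃-sym (ℚᵘP.≃-trans (ℚP.toℚᵘ-homo-* (ℚ.fromℚᵘ x) (ℚ.fromℚᵘ y))
                          (ℚᵘP.*-cong (ℚP.toℚᵘ-fromℚᵘ x) (ℚP.toℚᵘ-fromℚᵘ y)))))

fromℚᵘ-homo-neg : (x : ℚᵘ) → ℚ.fromℚᵘ (ℚᵘ.- x) ≡ ℚ.- ℚ.fromℚᵘ x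
fromℚᵘ-homo-neg x = ℚP.toℚᵘ-injective (ℚᵘP.≃-trans (ℚP.toℚᵘ-fromℚᵘ (ℚᵘ.- x))
  (ℚᵘP.≃-sym (ℚᵘP.≃-trans (ℚP.toℚᵘ-homo‿- (ℚ.fromℚᵘ x)) (ℚᵘP.-‿cong (ℚP.toℚᵘ-fromℚᵘ x)))))

p/d≡q/d′ : (p q : ℤ) (d d′ : ℕ) .{{_ : ℕ.NonZero d}} .{{_ : ℕ.NonZero d′}} →
           p * + d′ ≡ q * + d → p / d ≡ q / d′
p/d≡q/d′ p q (suc d) (suc d′) eq = ℚP.fromℚᵘ-cong {mkℚᵘ p d} {mkℚᵘ q d′} (*≡* eq)

p/d+q/d≡[p+q]/d : (p q : ℤ) (d : ℕ) .{{_ : ℕ.NonZero d}} → p / d ℚ.+ q / d ≡ (p + q) / d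
p/d+q/d≡[p+q]/d p q d@(suc _) = trans (sym (fromℚᵘ-homo-+ (mkℚᵘ p _) (mkℚᵘ q _)))
  (p/d≡q/d′ (p * + d + q * + d) (p + q) (d ℕ.* d) d
    (trans (solve 3 (λ p q d → (p :* d :+ q :* d) :* d := (p :+ q) :* (d :* d)) refl p q (+ d))
           (cong ((p + q) *_) (sym (ℤP.pos-* d d)))))

-[p/d]≡[-p]/d : (p : ℤ) (d : ℕ) .{{_ : ℕ.NonZero d}} → ℚ.- (p / d) ≡ (- p) / d
-[p/d]≡[-p]/d p (suc _) = sym (fromℚᵘ-homo-neg (mkℚᵘ p _))

p/d-q/d≡[p-q]/d : (p q : ℤ) (d : ℕ) .{{_ : ℕ.NonZero d}} → p / d ℚ.- q / d ≡ (p - q) / d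
p/d-q/d≡[p-q]/d p q d = trans (cong (p / d ℚ.+_) (-[p/d]≡[-p]/d q d)) (p/d+q/d≡[p+q]/d p (- q) d)

[p/d]*[q/d′]≡r/D : (p q r : ℤ) (d d′ D : ℕ) .{{_ : ℕ.NonZero d}} .{{_ : ℕ.NonZero d′}} .{{_ : ℕ.NonZero D}} →
                   p * q * + D ≡ r * (+ d * + d′) → (p / d) ℚ.* (q / d′) ≡ r / D
[p/d]*[q/d′]≡r/D p q r d@(suc _) d′@(suc _) D eq = trans (sym (fromℚᵘ-homo-* (mkℚᵘ p _) (mkℚᵘ q _)))
  (p/d≡q/d′ (p * q) r (d ℕ.* d′) D (trans eq (cong (r *_) (sym (ℤP.pos-* d d′)))))

two*[p/d]≡[2p]/d : (p : ℤ) (d : ℕ) .{{_ : ℕ.NonZero d}} → two ℚ.* (p / d) ≡ (+ 2 * p) / d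
two*[p/d]≡[2p]/d p d = [p/d]*[q/d′]≡r/D (+ 2) p (+ 2 * p) 1 d d
  (solve 2 (λ p d → (con (+ 2) :* p) :* d := (con (+ 2) :* p) :* (con (+ 1) :* d)) refl p (+ d))

∑/d : (x : ℕ → ℤ) (l : List ℕ) (d : ℕ) .{{_ : ℕ.NonZero d}} →
      foldr ℚ._+_ ℚ.0ℚ (map (λ k → x k / d) l) ≡ ∑ x l / d
∑/d x []      d = sym (ℚP.0/n≡0 d)
∑/d x (k ∷ l) d = trans (cong (x k / d ℚ.+_) (∑/d x l d)) (p/d+q/d≡[p+q]/d (x k) (∑ x l) d)

egf-⋆ : (a b : Seq) → egf a ⊛ egf b ≐ egf (a ⋆ b)
egf-⋆ a b n = begin
  foldr ℚ._+_ ℚ.0ℚ (map (λ k → egf a k ℚ.* egf b (n ∸ k)) (upTo (suc n)))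
    ≡⟨ cong (foldr ℚ._+_ ℚ.0ℚ) (map-cong-local (All.tabulate (λ k∈ → term (ℕP.m<1+n⇒m≤n (∈-upTo⁻ k∈))))) ⟩
  foldr ℚ._+_ ℚ.0ℚ (map (λ k → (binomialTerm a b k (n ∸ k) / n !) {{n !≢0}}) (upTo (suc n)))
    ≡⟨ ∑/d (λ k → binomialTerm a b k (n ∸ k)) (upTo (suc n)) (n !) {{n !≢0}} ⟩
  (∑ (λ k → binomialTerm a b k (n ∸ k)) (upTo (suc n)) / n !) {{n !≢0}}
    ≡⟨ cong (λ x → (x / n !) {{n !≢0}})
            (trans (∑-upTo≡antidiagonal (binomialTerm a b) n) (sym (⋆≡antidiagonal a b n))) ⟩
  egf (a ⋆ b) n
    ∎
  where
  term : ∀ {k} → k ℕ.≤ n → egf a k ℚ.* egf b (n ∸ k) ≡ (binomialTerm a b k (n ∸ k) / n !) {{n !≢0}}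
  term {k} k≤n = [p/d]*[q/d′]≡r/D (a k) (b j) (binomialTerm a b k j) (k !) (j !) (n !) {{k !≢0}} {{j !≢0}} {{n !≢0}}
    (begin
      a k * b j * + (n !)
        ≡⟨ cong (λ m → a k * b j * + m) (sym (trans (binomial-factorials k j) (cong _! (ℕP.m+[n∸m]≡n k≤n)))) ⟩
      a k * b j * + (binomial k j ℕ.* (k ! ℕ.* j !))
        ≡⟨ cong (a k * b j *_) (trans (ℤP.pos-* (binomial k j) _) (cong (+ binomial k j *_) (ℤP.pos-* (k !) (j !)))) ⟩
      a k * b j * (+ binomial k j * (+ (k !) * + (j !)))
        ≡⟨ solve 5 (λ x y c f g → (x :* y) :* (c :* (f :* g)) := (c :* x :* y) :* (f :* g)) refl
                 (a k) (b j) (+ binomial k j) (+ (k !)) (+ (j !)) ⟩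
      binomialTerm a b k j * (+ (k !) * + (j !))
        ∎)
    where j = n ∸ k

egf-cong : {a b : Seq} → a ≗ b → egf a ≐ egf b
egf-cong a≗b n = cong (λ x → (x / n !) {{n !≢0}}) (a≗b n)

⊛-congʳ : (f : PS) {g g′ : PS} → g ≐ g′ → f ⊛ g ≐ f ⊛ g′
⊛-congʳ f g≐g′ n = cong (foldr ℚ._+_ ℚ.0ℚ) (map-cong (λ k → cong (f k ℚ.*_) (g≐g′ (n ∸ k))) (upTo (suc n)))

two·[cos⊖sin]≐egf : two · (cosS ⊖ sinS) ≐ egf (+ 2 ⊠ cos-sin)
two·[cos⊖sin]≐egf n = trans (cong (two ℚ.*_) (p/d-q/d≡[p-q]/d (cosD n) (sinD n) (n !) {{n !≢0}}))
                            (two*[p/d]≡[2p]/d (cos-sin n) (n !) {{n !≢0}})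

two·cos²⊖sin²≐egf : two · (cosS ⊛ cosS) ⊖ sinS ⊛ sinS ≐ egf (+ 2 ⊠ (cosD ⋆ cosD) ⊟ sinD ⋆ sinD)
two·cos²⊖sin²≐egf n = begin
  two ℚ.* (cosS ⊛ cosS) n ℚ.- (sinS ⊛ sinS) n
    ≡⟨ cong₂ (λ u v → two ℚ.* u ℚ.- v) (egf-⋆ cosD cosD n) (egf-⋆ sinD sinD n) ⟩
  two ℚ.* egf (cosD ⋆ cosD) n ℚ.- egf (sinD ⋆ sinD) n
    ≡⟨ cong (ℚ._- egf (sinD ⋆ sinD) n) (two*[p/d]≡[2p]/d ((cosD ⋆ cosD) n) (n !) {{n !≢0}}) ⟩
  egf (+ 2 ⊠ (cosD ⋆ cosD)) n ℚ.- egf (sinD ⋆ sinD) n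
    ≡⟨ p/d-q/d≡[p-q]/d (+ 2 * (cosD ⋆ cosD) n) ((sinD ⋆ sinD) n) (n !) {{n !≢0}} ⟩
  egf (+ 2 ⊠ (cosD ⋆ cosD) ⊟ sinD ⋆ sinD) n
    ∎

egf-⊛-two·[cos⊖sin] : (a r : Seq) {R : PS} → a ⋆ (+ 2 ⊠ cos-sin) ≗ r → R ≐ egf r →
                      egf a ⊛ (two · (cosS ⊖ sinS)) ≐ R
egf-⊛-two·[cos⊖sin] a r {R} a⋆2d≗r R≐ n = begin
  (egf a ⊛ (two · (cosS ⊖ sinS))) n    ≡⟨ ⊛-congʳ (egf a) two·[cos⊖sin]≐egf n ⟩
  (egf a ⊛ egf (+ 2 ⊠ cos-sin)) n      ≡⟨ egf-⋆ a (+ 2 ⊠ cos-sin) n ⟩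
  egf (a ⋆ (+ 2 ⊠ cos-sin)) n          ≡⟨ egf-cong a⋆2d≗r n ⟩
  egf r n                              ≡⟨ sym (R≐ n) ⟩
  R n                                  ∎

theorem68 : ((egf (λ n → + SD⁺ n) ⊛ (two · (cosS ⊖ sinS))) ≐ (two · (cosS ⊛ cosS) ⊖ sinS ⊛ sinS))
    × ((egf (λ n → + SD⁻ n) ⊛ (two · (cosS ⊖ sinS))) ≐ (sinS ⊛ sinS))
    × ((egf (λ n → + SBD⁺ n) ⊛ (two · (cosS ⊖ sinS))) ≐ (sinS ⊛ sinS))
    × ((egf (λ n → + SBD⁻ n) ⊛ (two · (cosS ⊖ sinS))) ≐ (sinS ⊛ sinS))
theorem68 =
    egf-⊛-two·[cos⊖sin] (λ n → + SD⁺ n) _ SD⁺⋆2[cos-sin] two·cos²⊖sin²≐egf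
  , egf-⊛-two·[cos⊖sin] (λ n → + SD⁻ n) _ (⋆2[cos-sin]≗sin² _ 4*SD⁻) sin²≐egf
  , egf-⊛-two·[cos⊖sin] (λ n → + SBD⁺ n) _ (⋆2[cos-sin]≗sin² _ 4*SBD⁺) sin²≐egf
  , egf-⊛-two·[cos⊖sin] (λ n → + SBD⁻ n) _ (⋆2[cos-sin]≗sin² _ 4*SBD⁻) sin²≐egf
  where
  sin²≐egf : sinS ⊛ sinS ≐ egf (sinD ⋆ sinD)
  sin²≐egf = egf-⋆ sinD sinD
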